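{- Let $n\ge 1$ and $0\le k$. The set of unit Fubini rankings of length $n$ having exactly $n-k$ distinct values (ranks) is in bijection with the set of Boolean intervals of rank $k$ in the right weak order $W(\mathfrak{S}_n)$.
   Context: $[n]=\{1,\ldots,n\}$. Parking process: a tuple $\alpha=(a_1,\ldots,a_n)\in[n]^n$ encodes preferences of cars $1,\ldots,n$ arriving in this order at a one-way street with spots $1,\ldots,n$; car $i$ parks in spot $a_i$ if free, otherwise in the first free spot after $a_i$, if any. $\alpha$ is a parking function if all cars park (equivalently its weakly increasing rearrangement $a'_1\le\cdots\le a'_n$ satisfies $a'_i\le i$ for all $i$). A unit interval parking function is a parking function in which every car $i$ parks in spot $a_i$ or $a_i+1$. A Fubini ranking of length $n$ is a tuple $(r_1,\ldots,r_n)\in[n]^n$ recording a ranking of $n$ competitors with ties allowed, where if $m$ competitors tie at rank $r$ then ranks $r+1,\ldots,r+m-1$ are not used; formally, $r_i=1+|\{j:r_j<r_i\}|$ for every $i$. A unit Fubini ranking is a tuple that is both a Fubini ranking and a unit interval parking function. The right weak order $W(\mathfrak{S}_n)$ is the partial order on $\mathfrak{S}_n$ with cover relations $\tau\lessdot\tau s_i$ whenever $\tau(i)<\tau(i+1)$, where $s_i=(i,i+1)$. An interval $[v,w]=\{u:v\le u\le w\}$ is a Boolean interval of rank $k$ if it is isomorphic as a poset to the lattice of subsets of a $k$-element set; $[\pi,\pi]$ has rank $0$. -}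

module Defs where

open import Data.Nat using (ℕ; zero; suc; _≤_; _<_; _<?_; _≤?_; _≟_)
open import Data.Fin using (Fin; toℕ)
open import Data.Fin.Subset using (Subset; _⊆_)
open import Data.List using (List; []; _∷_; filter; head; length; map; upTo; zip; deduplicate)
open import Data.List.Relation.Unary.All using (All)
open import Data.List.Relation.Unary.Unique.Propositional using (Unique)
open import Data.List.Membership.DecPropositional _≟_ using (_∈?_)
open import Data.Vec using (Vec; toList; lookup; _[_]≔_)
open import Data.Maybe using (Maybe; just; nothing)
open import Data.Product using (Σ; ∃; _×_; _,_)
open import Data.Sum using (_⊎_)
open import Relation.Nullary using (¬?)
open import Relation.Nullary.Decidable using (_×-dec_)
open import Relation.Binary.PropositionalEquality using (_≡_)
open import Relation.Binary.Construct.Closure.ReflexiveTransitive using (Star)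
open import Function.Bundles using (_⇔_)

InRange : (n : ℕ) → Vec ℕ n → Set
InRange n α = All (λ a → 1 ≤ a × a ≤ n) (toList α)

spots : ℕ → List ℕ
spots n = map suc (upTo n)

firstFree : (n : ℕ) → List ℕ → ℕ → Maybe ℕ
firstFree n occ a = head (filter (λ s → (a ≤? s) ×-dec ¬? (s ∈? occ)) (spots n))

-- parking process: outcome of each car (nothing = car fails to park)
outcomes : (n : ℕ) → List ℕ → List ℕ → List (Maybe ℕ)
outcomes n occ [] = []
outcomes n occ (a ∷ as) with firstFree n occ a
... | nothing = nothing ∷ outcomes n occ as
... | just s  = just s ∷ outcomes n (s ∷ occ) as

parkingOutcome : (n : ℕ) → Vec ℕ n → List (Maybe ℕ)
parkingOutcome n α = outcomes n [] (toList α)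

IsParkingFunction : (n : ℕ) → Vec ℕ n → Set
IsParkingFunction n α =
  InRange n α × All (λ o → ∃ λ s → o ≡ just s) (parkingOutcome n α)

IsUnitIntervalPF : (n : ℕ) → Vec ℕ n → Set
IsUnitIntervalPF n α =
  IsParkingFunction n α ×
  All (λ p → Data.Product.proj₂ p ≡ just (Data.Product.proj₁ p)
           ⊎ Data.Product.proj₂ p ≡ just (suc (Data.Product.proj₁ p)))
      (zip (toList α) (parkingOutcome n α))

IsFubiniRanking : (n : ℕ) → Vec ℕ n → Set
IsFubiniRanking n r =
  InRange n r ×
  ((i : Fin n) → lookup r i ≡ suc (length (filter (λ x → x <? lookup r i) (toList r))))

IsUnitFubini : (n : ℕ) → Vec ℕ n → Set
IsUnitFubini n r = IsFubiniRanking n r × IsUnitIntervalPF n r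

distinctCount : {n : ℕ} → Vec ℕ n → ℕ
distinctCount r = length (deduplicate _≟_ (toList r))

-- permutations of [n] in one-line notation (τ(1),…,τ(n))
IsPerm : (n : ℕ) → Vec ℕ n → Set
IsPerm n τ = InRange n τ × Unique (toList τ)

-- cover relation of the right weak order: τ ⋖ τ s_i when τ(i) < τ(i+1);
-- τ s_i swaps the entries in positions i and i+1
Cover : (n : ℕ) → Vec ℕ n → Vec ℕ n → Set
Cover n τ σ = Σ (Fin n) λ i → Σ (Fin n) λ j →
  toℕ j ≡ suc (toℕ i) × lookup τ i < lookup τ j ×
  σ ≡ ((τ [ i ]≔ lookup τ j) [ j ]≔ lookup τ i)

WeakLe : (n : ℕ) → Vec ℕ n → Vec ℕ n → Set
WeakLe n = Star (Cover n)

InInterval : (n : ℕ) → Vec ℕ n → Vec ℕ n → Vec ℕ n → Set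
InInterval n v w u = WeakLe n v u × WeakLe n u w

IsBooleanOfRank : (n k : ℕ) → Vec ℕ n → Vec ℕ n → Set
IsBooleanOfRank n k v w =
  Σ (Vec ℕ n → Subset k) λ f → Σ (Subset k → Vec ℕ n) λ g →
    ((S : Subset k) → InInterval n v w (g S)) ×
    ((S : Subset k) → f (g S) ≡ S) ×
    ((u : Vec ℕ n) → InInterval n v w u → g (f u) ≡ u) ×
    ((u u′ : Vec ℕ n) → InInterval n v w u → InInterval n v w u′ →
       (WeakLe n u u′ ⇔ f u ⊆ f u′))

-- a Boolean interval [v,w] of rank k in W(S_n), recorded by its endpoints
IsBooleanInterval : (n k : ℕ) → Vec ℕ n × Vec ℕ n → Set
IsBooleanInterval n k (v , w) =
  IsPerm n v × IsPerm n w × WeakLe n v w × IsBooleanOfRank n k v w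

SubsetBijection : {A B : Set} → (A → Set) → (B → Set) → Set
SubsetBijection {A} {B} P Q =
  Σ (A → B) λ F → Σ (B → A) λ G →
    ((x : A) → P x → Q (F x)) ×
    ((y : B) → Q y → P (G y)) ×
    ((x : A) → P x → G (F x) ≡ x) ×
    ((y : B) → Q y → F (G y) ≡ y)

-- A Boolean interval [v, w] of rank k in the right weak order is determined by v and the set K of
-- positions of its k atoms v ⋖ v sᵢ; these are pairwise non-adjacent ascents of v, and w = v ∏_{i∈K} sᵢ.
-- Such a pair (v, K) is turned into a ranking by letting the competitors finish in the order listed
-- by v, the competitor right after each i ∈ K tying with its left neighbour. Every rank is then
-- shared by at most two consecutive finishers, which makes the ranking a unit interval parking
-- function (its cars park in the spots given by v⁻¹), and it has n − k distinct ranks. Conversely,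
-- a unit interval parking function takes each value at most twice, so sorting the competitors of a
-- unit Fubini ranking by rank and then by arrival recovers v, and the ties recover K.

module Submission where

open import Defs
open import Data.Nat
open import Data.Nat.Properties
open import Data.Bool using (Bool; true; false; if_then_else_; _∧_; _∨_; not)
open import Data.Bool.Properties using (∨-zeroʳ; ∨-identityʳ; ∧-zeroʳ; ∧-identityʳ)
open import Data.Empty using (⊥; ⊥-elim)
open import Data.Fin as Fin using (Fin; toℕ; fromℕ<)
import Data.Fin.Properties as Finₚ
open import Data.Fin.Subset using (Subset; _⊆_) renaming (_∈_ to _∈ₛ_)
open import Data.List using (List; []; _∷_; applyUpTo; filter; length; head; zip; deduplicate)
open import Data.List.Properties using (filter-accept; filter-reject; map-applyUpTo)
open import Data.List.Membership.Propositional using (_∈_; _∉_)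
open import Data.List.Membership.Propositional.Properties using (∈-deduplicate⁻; ∈-deduplicate⁺)
open import Data.List.Membership.DecPropositional _≟_ using (_∈?_)
open import Data.List.Relation.Unary.All as All using (All; []; _∷_)
import Data.List.Relation.Unary.AllPairs as AllPairs
open import Data.List.Relation.Unary.Any as Any using (here; there)
open import Data.List.Relation.Unary.Unique.Propositional using (Unique)
open import Data.List.Relation.Unary.Unique.DecPropositional.Properties using (deduplicate-!)
open import Data.Maybe using (Maybe; just; nothing)
open import Data.Product using (Σ; ∃; _×_; _,_; proj₁; proj₂)
open import Data.Sum using (_⊎_; inj₁; inj₂)
open import Data.Vec using (Vec; []; _∷_; lookup; toList; _[_]≔_)
open import Data.Vec.Properties using ([]=⇒lookup; lookup⇒[]=)
open import Function using (_∘_; id)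
open import Function.Bundles using (_⇔_; mk⇔; Equivalence)
open import Relation.Binary.Construct.Closure.ReflexiveTransitive using (Star; ε; _◅_; _◅◅_)
open import Relation.Binary.Definitions using (tri<; tri≈; tri>)
open import Relation.Binary.PropositionalEquality
open import Relation.Nullary
open import Relation.Nullary.Decidable using (_×-dec_)
open import Relation.Unary using (Pred; Decidable)

-- Finite sums and counts below a bound

Σ< : ℕ → (ℕ → ℕ) → ℕ
Σ< zero f = 0
Σ< (suc n) f = Σ< n f + f n

indicator : Bool → ℕ
indicator true = 1
indicator false = 0

indicator≤1 : ∀ b → indicator b ≤ 1
indicator≤1 true = ≤-refl
indicator≤1 false = z≤n

count : ℕ → (ℕ → Bool) → ℕ
count n P = Σ< n (λ p → indicator (P p))

Σ-cong : ∀ n f g → (∀ p → p < n → f p ≡ g p) → Σ< n f ≡ Σ< n g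
Σ-cong zero f g h = refl
Σ-cong (suc n) f g h = cong₂ _+_ (Σ-cong n f g (λ p lt → h p (m≤n⇒m≤1+n lt))) (h n ≤-refl)

Σ-shift : ∀ n f → Σ< (suc n) f ≡ f 0 + Σ< n (f ∘ suc)
Σ-shift zero f = +-comm 0 (f 0)
Σ-shift (suc n) f = trans (cong (_+ f (suc n)) (Σ-shift n f)) (+-assoc (f 0) _ _)

Σ-+-distrib : ∀ n f g → Σ< n (λ p → f p + g p) ≡ Σ< n f + Σ< n g
Σ-+-distrib zero f g = refl
Σ-+-distrib (suc n) f g = trans (cong (_+ (f n + g n)) (Σ-+-distrib n f g)) (lemma (Σ< n f) (Σ< n g) (f n) (g n))
  where
  lemma : ∀ a b c d → a + b + (c + d) ≡ a + c + (b + d)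
  lemma a b c d = trans (+-assoc a b (c + d)) (trans (cong (a +_) (trans (sym (+-assoc b c d))
      (trans (cong (_+ d) (+-comm b c)) (+-assoc c b d)))) (sym (+-assoc a c (b + d))))

Σ-zero : ∀ n f → (∀ p → p < n → f p ≡ 0) → Σ< n f ≡ 0
Σ-zero zero f h = refl
Σ-zero (suc n) f h = trans (cong₂ _+_ (Σ-zero n f (λ p lt → h p (m≤n⇒m≤1+n lt))) (h n ≤-refl)) refl

Σ-comm : ∀ n m (f : ℕ → ℕ → ℕ) → Σ< n (λ x → Σ< m (λ y → f x y)) ≡ Σ< m (λ y → Σ< n (λ x → f x y))
Σ-comm zero m f = sym (Σ-zero m (λ _ → 0) (λ _ _ → refl))
Σ-comm (suc n) m f = trans (cong (_+ Σ< m (f n)) (Σ-comm n m f)) (sym (Σ-+-distrib m _ _))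

Σ-mono : ∀ n f g → (∀ p → p < n → f p ≤ g p) → Σ< n f ≤ Σ< n g
Σ-mono zero f g h = z≤n
Σ-mono (suc n) f g h = +-mono-≤ (Σ-mono n f g (λ p lt → h p (m≤n⇒m≤1+n lt))) (h n ≤-refl)

Σ-single : ∀ n f a → a < n → (∀ p → p < n → p ≢ a → f p ≡ 0) → Σ< n f ≡ f a
Σ-single zero f a () h
Σ-single (suc n) f a lt h with a ≟ n
... | yes refl = trans (cong (_+ f a) (Σ-zero n f (λ p l → h p (m≤n⇒m≤1+n l) (λ e → <-irrefl e l)))) refl
... | no ne = trans (cong₂ _+_ (Σ-single n f a (≤∧≢⇒< (≤-pred lt) ne) (λ p l → h p (m≤n⇒m≤1+n l)))
                        (h n ≤-refl (λ e → ne (sym e)))) (+-identityʳ _)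

Σ≢0⇒∃ : ∀ n f → Σ< n f ≢ 0 → ∃ λ p → p < n × f p ≢ 0
Σ≢0⇒∃ zero f ne = ⊥-elim (ne refl)
Σ≢0⇒∃ (suc n) f ne with f n ≟ 0
... | no fn = n , ≤-refl , fn
... | yes fn with Σ≢0⇒∃ n f (λ e → ne (trans (cong₂ _+_ e fn) refl))
...   | p , lt , q = p , m≤n⇒m≤1+n lt , q

Σ-one : ∀ n → Σ< n (λ _ → 1) ≡ n
Σ-one zero = refl
Σ-one (suc n) = trans (cong (_+ 1) (Σ-one n)) (+-comm n 1)

Σ-≤1 : ∀ n g → (∀ y → y < n → g y ≤ 1) → Σ< n g ≤ n
Σ-≤1 n g h = ≤-trans (Σ-mono n g (λ _ → 1) h) (≤-reflexive (Σ-one n))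

private
  +-saturated : ∀ a b n → a ≤ n → b ≤ 1 → a + b ≡ suc n → a ≡ n × b ≡ 1
  +-saturated a zero n le _ e = ⊥-elim (<-irrefl (trans (sym (+-identityʳ a)) e) (s≤s le))
  +-saturated a (suc zero) n le _ e = suc-injective (trans (+-comm 1 a) e) , refl
  +-saturated a (suc (suc b)) n le (s≤s ()) e

Σ-≤1-saturated : ∀ n g → (∀ y → y < n → g y ≤ 1) → Σ< n g ≡ n → ∀ y → y < n → g y ≡ 1
Σ-≤1-saturated zero g h e y ()
Σ-≤1-saturated (suc n) g h e y lt with +-saturated (Σ< n g) (g n) n (Σ-≤1 n g (λ p l → h p (m≤n⇒m≤1+n l))) (h n ≤-refl) e
... | e1 , e2 with y ≟ n
...   | yes refl = e2
...   | no ne = Σ-≤1-saturated n g (λ p l → h p (m≤n⇒m≤1+n l)) e1 y (≤∧≢⇒< (≤-pred lt) ne)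

δ : ℕ → ℕ → ℕ
δ x y with x ≟ y
... | yes _ = 1
... | no _ = 0

δ-refl : ∀ x → δ x x ≡ 1
δ-refl x with x ≟ x
... | yes _ = refl
... | no ne = ⊥-elim (ne refl)

δ-ne : ∀ x y → x ≢ y → δ x y ≡ 0
δ-ne x y ne with x ≟ y
... | yes e = ⊥-elim (ne e)
... | no _ = refl

δ-pos : ∀ x y → δ x y ≢ 0 → x ≡ y
δ-pos x y ne with x ≟ y
... | yes e = e
... | no _ = ⊥-elim (ne refl)

InjectiveBelow : (n : ℕ) → (ℕ → ℕ) → Set
InjectiveBelow n f = ∀ p q → p < n → q < n → f p ≡ f q → p ≡ q

Σ-*ʳ : ∀ n g c → Σ< n (λ x → g x * c) ≡ Σ< n g * c
Σ-*ʳ zero g c = refl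
Σ-*ʳ (suc n) g c = trans (cong (_+ g n * c) (Σ-*ʳ n g c)) (sym (*-distribʳ-+ c (Σ< n g) (g n)))

fibre-size≤1 : ∀ n q → InjectiveBelow n q → ∀ y → Σ< n (λ x → δ (q x) y) ≤ 1
fibre-size≤1 zero q inj y = z≤n
fibre-size≤1 (suc n) q inj y = go (q n ≟ y)
  where
  go : Dec (q n ≡ y) → Σ< n (λ x → δ (q x) y) + δ (q n) y ≤ 1
  go (yes e) = subst (_≤ 1) (sym (trans (cong₂ _+_ (Σ-zero n _ (λ p lt → δ-ne (q p) y (λ e' →
              <-irrefl (inj p n (m≤n⇒m≤1+n lt) ≤-refl (trans e' (sym e))) lt))) (trans (cong (λ z → δ z y) e) (δ-refl y))) refl)) ≤-refl
  go (no ne) = subst (_≤ 1) (sym (trans (cong (Σ< n (λ x → δ (q x) y) +_) (δ-ne (q n) y ne)) (+-identityʳ _)))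
                (fibre-size≤1 n q (λ a b la lb → inj a b (m≤n⇒m≤1+n la) (m≤n⇒m≤1+n lb)) y)

fibre-size≡1 : ∀ n q → InjectiveBelow n q → (∀ x → x < n → q x < n) → ∀ y → y < n → Σ< n (λ x → δ (q x) y) ≡ 1
fibre-size≡1 n q inj rng = Σ-≤1-saturated n (λ y → Σ< n (λ x → δ (q x) y)) (λ y _ → fibre-size≤1 n q inj y) tot
  where
  tot : Σ< n (λ y → Σ< n (λ x → δ (q x) y)) ≡ n
  tot = trans (sym (Σ-comm n n (λ x y → δ (q x) y)))
        (trans (Σ-cong n _ (λ _ → 1) (λ x lt → trans (Σ-single n (δ (q x)) (q x) (rng x lt)
                   (λ p _ ne → δ-ne (q x) p (λ e → ne (sym e)))) (δ-refl (q x))))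
               (Σ-one n))

injective⇒surjective : ∀ n q → InjectiveBelow n q → (∀ x → x < n → q x < n) → ∀ y → y < n → ∃ λ x → x < n × q x ≡ y
injective⇒surjective n q inj rng y lt with Σ≢0⇒∃ n (λ x → δ (q x) y) (λ e → 1+n≢0 (trans (sym (fibre-size≡1 n q inj rng y lt)) e))
... | x , l , ne = x , l , δ-pos (q x) y ne

Σ-reindex : ∀ n q f → InjectiveBelow n q → (∀ x → x < n → q x < n) → Σ< n (f ∘ q) ≡ Σ< n f
Σ-reindex n q f inj rng = begin
  Σ< n (f ∘ q) ≡⟨ Σ-cong n _ _ (λ x lt → sym (trans (Σ-single n (λ y → δ (q x) y * f y) (q x) (rng x lt)
                    (λ p _ ne → cong (_* f p) (δ-ne (q x) p (λ e → ne (sym e)))))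
                    (trans (cong (_* f (q x)) (δ-refl (q x))) (+-identityʳ _)))) ⟩
  Σ< n (λ x → Σ< n (λ y → δ (q x) y * f y)) ≡⟨ Σ-comm n n _ ⟩
  Σ< n (λ y → Σ< n (λ x → δ (q x) y * f y)) ≡⟨ Σ-cong n _ _ (λ y lt → trans (Σ-*ʳ n _ (f y))
                    (trans (cong (_* f y) (fibre-size≡1 n q inj rng y lt)) (+-identityʳ _))) ⟩
  Σ< n f ∎
  where open ≡-Reasoning

-- Vectors indexed by ℕ and the weak order

-- Positions are 0-based naturals; a lookup out of range returns the default value.
nthOr : ∀ {A : Set} {n} → A → Vec A n → ℕ → A
nthOr d [] _ = d
nthOr d (x ∷ xs) zero = x
nthOr d (x ∷ xs) (suc p) = nthOr d xs p

nth : ∀ {n} → Vec ℕ n → ℕ → ℕ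
nth = nthOr 0

lookup≡nthOr : ∀ {A : Set} {n} (d : A) (v : Vec A n) (i : Fin n) → lookup v i ≡ nthOr d v (toℕ i)
lookup≡nthOr d (x ∷ v) Fin.zero = refl
lookup≡nthOr d (x ∷ v) (Fin.suc i) = lookup≡nthOr d v i

lookup≡nth : ∀ {n} (v : Vec ℕ n) (i : Fin n) → lookup v i ≡ nth v (toℕ i)
lookup≡nth = lookup≡nthOr 0

nth-outside : ∀ {n} (v : Vec ℕ n) p → n ≤ p → nth v p ≡ 0
nth-outside [] p _ = refl
nth-outside (x ∷ v) (suc p) (s≤s le) = nth-outside v p le

tabulateN : ∀ {A : Set} (n : ℕ) → (ℕ → A) → Vec A n
tabulateN zero h = []
tabulateN (suc n) h = h 0 ∷ tabulateN n (h ∘ suc)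

nthOr-tabulateN : ∀ {A : Set} (d : A) n h p → p < n → nthOr d (tabulateN n h) p ≡ h p
nthOr-tabulateN d (suc n) h zero _ = refl
nthOr-tabulateN d (suc n) h (suc p) (s≤s lt) = nthOr-tabulateN d n (h ∘ suc) p lt

nth-tabulateN : ∀ n h p → p < n → nth (tabulateN n h) p ≡ h p
nth-tabulateN = nthOr-tabulateN 0

nthOr-ext : ∀ {A : Set} (d : A) {n} (u v : Vec A n) → (∀ p → p < n → nthOr d u p ≡ nthOr d v p) → u ≡ v
nthOr-ext d [] [] _ = refl
nthOr-ext d (x ∷ u) (y ∷ v) h = cong₂ _∷_ (h 0 (s≤s z≤n)) (nthOr-ext d u v (λ p lt → h (suc p) (s≤s lt)))

nth-ext : ∀ {n} (u v : Vec ℕ n) → (∀ p → p < n → nth u p ≡ nth v p) → u ≡ v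
nth-ext = nthOr-ext 0

nth-update-same : ∀ {n} (v : Vec ℕ n) (i : Fin n) y p → p ≡ toℕ i → nth (v [ i ]≔ y) p ≡ y
nth-update-same (x ∷ v) Fin.zero y .0 refl = refl
nth-update-same (x ∷ v) (Fin.suc i) y .(suc (toℕ i)) refl = nth-update-same v i y _ refl

nth-update-other : ∀ {n} (v : Vec ℕ n) (i : Fin n) y p → p ≢ toℕ i → nth (v [ i ]≔ y) p ≡ nth v p
nth-update-other (x ∷ v) Fin.zero y zero ne = ⊥-elim (ne refl)
nth-update-other (x ∷ v) Fin.zero y (suc p) ne = refl
nth-update-other (x ∷ v) (Fin.suc i) y zero ne = refl
nth-update-other (x ∷ v) (Fin.suc i) y (suc p) ne = nth-update-other v i y p (λ e → ne (cong suc e))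

adjSwap : ℕ → ℕ → ℕ
adjSwap i p with p ≟ i
... | yes _ = suc i
... | no _ with p ≟ suc i
...   | yes _ = i
...   | no _ = p

adjSwap-left : ∀ i → adjSwap i i ≡ suc i
adjSwap-left i with i ≟ i
... | yes _ = refl
... | no ne = ⊥-elim (ne refl)

adjSwap-right : ∀ i → adjSwap i (suc i) ≡ i
adjSwap-right i with suc i ≟ i
... | yes e = ⊥-elim (1+n≢n e)
... | no _ with suc i ≟ suc i
...   | yes _ = refl
...   | no ne = ⊥-elim (ne refl)

adjSwap-other : ∀ i p → p ≢ i → p ≢ suc i → adjSwap i p ≡ p
adjSwap-other i p a b with p ≟ i
... | yes e = ⊥-elim (a e)
... | no _ with p ≟ suc i
...   | yes e = ⊥-elim (b e)
...   | no _ = refl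

CoverAt : (n : ℕ) → Vec ℕ n → Vec ℕ n → Set
CoverAt n τ σ = Σ ℕ λ i → suc i < n × nth τ i < nth τ (suc i) × (∀ p → nth σ p ≡ nth τ (adjSwap i p))

Cover⇒CoverAt : ∀ n τ σ → Cover n τ σ → CoverAt n τ σ
Cover⇒CoverAt n τ σ (i , j , ji , lt , refl) =
  toℕ i , subst (_< n) ji (Finₚ.toℕ<n j) ,
  subst₂ _<_ (lookup≡nth τ i) (trans (lookup≡nth τ j) (cong (nth τ) ji)) lt , h
  where
  h : ∀ p → nth ((τ [ i ]≔ lookup τ j) [ j ]≔ lookup τ i) p ≡ nth τ (adjSwap (toℕ i) p)
  h p = h' p (p ≟ toℕ i) (p ≟ toℕ j)
    where
    open ≡-Reasoning
    h' : ∀ p → Dec (p ≡ toℕ i) → Dec (p ≡ toℕ j) → nth ((τ [ i ]≔ lookup τ j) [ j ]≔ lookup τ i) p ≡ nth τ (adjSwap (toℕ i) p)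
    h' p (yes e) _ = begin
      nth ((τ [ i ]≔ lookup τ j) [ j ]≔ lookup τ i) p
        ≡⟨ nth-update-other (τ [ i ]≔ lookup τ j) j (lookup τ i) p (λ e' → 1+n≢n (trans (sym ji) (trans (sym e') e))) ⟩
      nth (τ [ i ]≔ lookup τ j) p ≡⟨ nth-update-same τ i (lookup τ j) p e ⟩
      lookup τ j ≡⟨ lookup≡nth τ j ⟩
      nth τ (toℕ j) ≡⟨ cong (nth τ) ji ⟩
      nth τ (suc (toℕ i)) ≡⟨ cong (nth τ) (sym (trans (cong (adjSwap (toℕ i)) e) (adjSwap-left (toℕ i)))) ⟩
      nth τ (adjSwap (toℕ i) p) ∎
    h' p (no ne) (yes e) = trans (nth-update-same (τ [ i ]≔ lookup τ j) j (lookup τ i) p e) (trans (lookup≡nth τ i)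
                   (cong (nth τ) (sym (trans (cong (adjSwap (toℕ i)) (trans e ji)) (adjSwap-right (toℕ i))))))
    h' p (no ne) (no ne2) = trans (nth-update-other (τ [ i ]≔ lookup τ j) j (lookup τ i) p ne2) (trans (nth-update-other τ i (lookup τ j) p ne)
                   (cong (nth τ) (sym (adjSwap-other (toℕ i) p ne (λ e → ne2 (trans e (sym ji)))))))

CoverAt⇒Cover : ∀ n τ σ → CoverAt n τ σ → Cover n τ σ
CoverAt⇒Cover n τ σ (i , si<n , lt , h) = i' , j' , ji , lt' , eq
  where
  i' : Fin n
  i' = fromℕ< (≤-trans (n≤1+n (suc i)) si<n)
  j' : Fin n
  j' = fromℕ< si<n
  ti : toℕ i' ≡ i
  ti = Finₚ.toℕ-fromℕ< _
  ji : toℕ j' ≡ suc (toℕ i')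
  ji = trans (Finₚ.toℕ-fromℕ< si<n) (cong suc (sym ti))
  lt' : lookup τ i' < lookup τ j'
  lt' = subst₂ _<_ (sym (trans (lookup≡nth τ i') (cong (nth τ) ti)))
                   (sym (trans (lookup≡nth τ j') (cong (nth τ) (Finₚ.toℕ-fromℕ< si<n)))) lt
  eq : σ ≡ ((τ [ i' ]≔ lookup τ j') [ j' ]≔ lookup τ i')
  eq = nth-ext _ _ (λ p _ → trans (h p) (trans (cong (λ z → nth τ (adjSwap z p)) (sym ti))
         (sym (proj₂ (proj₂ (proj₂ (Cover⇒CoverAt n τ _ (i' , j' , ji , lt' , refl)))) p))))

All⇒nth : ∀ {n} {P : ℕ → Set} (v : Vec ℕ n) → All P (toList v) → ∀ p → p < n → P (nth v p)
All⇒nth (x ∷ v) (px ∷ a) zero _ = px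
All⇒nth (x ∷ v) (px ∷ a) (suc p) (s≤s lt) = All⇒nth v a p lt

nth⇒All : ∀ {n} {P : ℕ → Set} (v : Vec ℕ n) → (∀ p → p < n → P (nth v p)) → All P (toList v)
nth⇒All [] h = []
nth⇒All (x ∷ v) h = h 0 (s≤s z≤n) ∷ nth⇒All v (λ p lt → h (suc p) (s≤s lt))

PermAt : (n : ℕ) → Vec ℕ n → Set
PermAt n v = (∀ p → p < n → 1 ≤ nth v p × nth v p ≤ n) × InjectiveBelow n (nth v)

Unique⇒injective : ∀ {n} (v : Vec ℕ n) → Unique (toList v) → InjectiveBelow n (nth v)
Unique⇒injective (x ∷ v) (a AllPairs.∷ u) zero zero _ _ _ = refl
Unique⇒injective (x ∷ v) (a AllPairs.∷ u) zero (suc q) _ (s≤s lt) e = ⊥-elim (All⇒nth v a q lt e)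
Unique⇒injective (x ∷ v) (a AllPairs.∷ u) (suc p) zero (s≤s lt) _ e = ⊥-elim (All⇒nth v a p lt (sym e))
Unique⇒injective (x ∷ v) (a AllPairs.∷ u) (suc p) (suc q) (s≤s l1) (s≤s l2) e = cong suc (Unique⇒injective v u p q l1 l2 e)

injective⇒Unique : ∀ {n} (v : Vec ℕ n) → InjectiveBelow n (nth v) → Unique (toList v)
injective⇒Unique [] _ = AllPairs.[]
injective⇒Unique (x ∷ v) h = nth⇒All v (λ p lt e → 0≢1+n (h 0 (suc p) (s≤s z≤n) (s≤s lt) e))
                     AllPairs.∷ injective⇒Unique v (λ p q l1 l2 e → suc-injective (h (suc p) (suc q) (s≤s l1) (s≤s l2) e))

IsPerm⇒PermAt : ∀ n v → IsPerm n v → PermAt n v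
IsPerm⇒PermAt n v (r , u) = All⇒nth v r , Unique⇒injective v u

PermAt⇒IsPerm : ∀ n v → PermAt n v → IsPerm n v
PermAt⇒IsPerm n v (r , u) = nth⇒All v r , injective⇒Unique v u

-- Products of commuting adjacent transpositions

-- applySwaps n v K is v ∏_{i∈K} sᵢ: when K has no two adjacent elements, position p of the
-- product holds v (partner K p).
Marks : Set
Marks = ℕ → Bool

leftPartner : Marks → ℕ → ℕ
leftPartner K zero = zero
leftPartner K (suc p) = if K p then p else suc p

partner : Marks → ℕ → ℕ
partner K p = if K p then suc p else leftPartner K p

data PartnerView (K : Marks) (p : ℕ) : ℕ → Set where
  moved-right : K p ≡ true → PartnerView K p (suc p)
  moved-left : ∀ p' → p ≡ suc p' → K p ≡ false → K p' ≡ true → PartnerView K p p'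
  fixed : K p ≡ false → (∀ p' → p ≡ suc p' → K p' ≡ false) → PartnerView K p p

partnerView : ∀ K p → PartnerView K p (partner K p)
partnerView K p with K p in e
... | true = moved-right e
partnerView K zero | false = fixed e (λ _ ())
partnerView K (suc p) | false with K p in e2
... | true = moved-left p refl e e2
... | false = fixed e (λ { p' refl → e2 })

true≢false : ∀ {b} → b ≡ true → b ≡ false → ⊥
true≢false refl ()

partner-marked : ∀ K p → K p ≡ true → partner K p ≡ suc p
partner-marked K p e with partner K p | partnerView K p
... | ._ | moved-right _ = refl
... | ._ | moved-left _ _ f _ = ⊥-elim (true≢false e f)
... | ._ | fixed f _ = ⊥-elim (true≢false e f)

partner-after-marked : ∀ K p → K (suc p) ≡ false → K p ≡ true → partner K (suc p) ≡ p
partner-after-marked K p f t with partner K (suc p) | partnerView K (suc p)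
... | ._ | moved-right t' = ⊥-elim (true≢false t' f)
... | ._ | moved-left p' refl _ _ = refl
... | ._ | fixed _ h = ⊥-elim (true≢false t (h p refl))

partner-unmarked : ∀ K p → K p ≡ false → (∀ p' → p ≡ suc p' → K p' ≡ false) → partner K p ≡ p
partner-unmarked K p f h with partner K p | partnerView K p
... | ._ | moved-right t' = ⊥-elim (true≢false t' f)
... | ._ | moved-left p' refl _ t = ⊥-elim (true≢false t (h p' refl))
... | ._ | fixed _ _ = refl

partner≤suc : ∀ K p → partner K p ≤ suc p
partner≤suc K p with partner K p | partnerView K p
... | ._ | moved-right _ = ≤-refl
... | ._ | moved-left p' refl _ _ = ≤-trans (n≤1+n _) (n≤1+n _)
... | ._ | fixed _ _ = n≤1+n p

≤suc-partner : ∀ K p → p ≤ suc (partner K p)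
≤suc-partner K p with partner K p | partnerView K p
... | ._ | moved-right _ = ≤-trans (n≤1+n p) (n≤1+n _)
... | ._ | moved-left p' refl _ _ = ≤-refl
... | ._ | fixed _ _ = n≤1+n p

partner≡suc⇒marked : ∀ K p → partner K p ≡ suc p → K p ≡ true
partner≡suc⇒marked K p e with partner K p | partnerView K p
... | ._ | moved-right t = t
... | ._ | moved-left p' refl _ _ = ⊥-elim (<-irrefl e (≤-trans (n<1+n p') (n≤1+n (suc p'))))
... | ._ | fixed _ _ = ⊥-elim (1+n≢n (sym e))

partner-cong : ∀ K1 K2 p → K1 p ≡ K2 p → (∀ p' → p ≡ suc p' → K1 p' ≡ K2 p') → partner K1 p ≡ partner K2 p
partner-cong K1 K2 zero e h = cong (λ b → if b then 1 else 0) e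
partner-cong K1 K2 (suc p) e h rewrite e | h p refl = refl

_⊆ₘ_ : Marks → Marks → Set
K1 ⊆ₘ K2 = ∀ p → K1 p ≡ true → K2 p ≡ true

Admissible : (n : ℕ) → Vec ℕ n → Marks → Set
Admissible n v K = PermAt n v × (∀ p → K p ≡ true → suc p < n) ×
  (∀ p → K p ≡ true → K (suc p) ≡ false) × (∀ p → K p ≡ true → nth v p < nth v (suc p))

applySwaps : (n : ℕ) → Vec ℕ n → Marks → Vec ℕ n
applySwaps n v K = tabulateN n (λ p → nth v (partner K p))

module _ {n : ℕ} {v : Vec ℕ n} {K : Marks} (val : Admissible n v K) where
  private
    v-injective = proj₂ (proj₁ val)
    marked⇒suc<n = proj₁ (proj₂ val)
    marked⇒next-unmarked = proj₁ (proj₂ (proj₂ val))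
    marked⇒ascent = proj₂ (proj₂ (proj₂ val))

  marked⇒prev-unmarked : ∀ p p' → K p ≡ true → p ≡ suc p' → K p' ≡ false
  marked⇒prev-unmarked p p' t refl with K p' in e
  ... | true = ⊥-elim (true≢false t (marked⇒next-unmarked p' e))
  ... | false = refl

  partner-< : ∀ K' → K' ⊆ₘ K → ∀ p → p < n → partner K' p < n
  partner-< K' sub p lt with partner K' p | partnerView K' p
  ... | ._ | moved-right t = marked⇒suc<n p (sub p t)
  ... | ._ | moved-left p' refl _ _ = ≤-trans (n≤1+n _) lt
  ... | ._ | fixed _ _ = lt

  partner-involutive : ∀ K' → K' ⊆ₘ K → ∀ p → partner K' (partner K' p) ≡ p
  partner-involutive K' sub p with partner K' p | partnerView K' p
  ... | ._ | moved-right t = partner-after-marked K' p (f (K' (suc p)) refl) t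
    where f : ∀ b → K' (suc p) ≡ b → K' (suc p) ≡ false
          f true e = ⊥-elim (true≢false (sub (suc p) e) (marked⇒next-unmarked p (sub p t)))
          f false e = e
  ... | ._ | moved-left p' refl _ t = partner-marked K' p' t
  ... | ._ | fixed f h = partner-unmarked K' p f h

adjSwap-cases : ∀ i p → (p ≡ i × adjSwap i p ≡ suc i) ⊎ (p ≡ suc i × adjSwap i p ≡ i) ⊎ (p ≢ i × p ≢ suc i × adjSwap i p ≡ p)
adjSwap-cases i p = go (p ≟ i) (p ≟ suc i)
  where
  go : Dec (p ≡ i) → Dec (p ≡ suc i) → (p ≡ i × adjSwap i p ≡ suc i) ⊎ (p ≡ suc i × adjSwap i p ≡ i) ⊎ (p ≢ i × p ≢ suc i × adjSwap i p ≡ p)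
  go (yes refl) _ = inj₁ (refl , adjSwap-left i)
  go (no a) (yes refl) = inj₂ (inj₁ (refl , adjSwap-right i))
  go (no a) (no b) = inj₂ (inj₂ (a , b , adjSwap-other i p a b))

adjSwap-involutive : ∀ i p → adjSwap i (adjSwap i p) ≡ p
adjSwap-involutive i p with adjSwap-cases i p
... | inj₁ (refl , e) = trans (cong (adjSwap i) e) (adjSwap-right i)
... | inj₂ (inj₁ (refl , e)) = trans (cong (adjSwap i) e) (adjSwap-left i)
... | inj₂ (inj₂ (a , b , e)) = trans (cong (adjSwap i) e) e

adjSwap-< : ∀ n i q → suc i < n → q < n → adjSwap i q < n
adjSwap-< n i q si q<n with adjSwap-cases i q
... | inj₁ (refl , e) = subst (_< n) (sym e) si
... | inj₂ (inj₁ (refl , e)) = subst (_< n) (sym e) (≤-trans (n≤1+n _) si)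
... | inj₂ (inj₂ (_ , _ , e)) = subst (_< n) (sym e) q<n

adjSwap-<-mono : ∀ i p q → p < q → ¬ (p ≡ i × q ≡ suc i) → adjSwap i p < adjSwap i q
adjSwap-<-mono i p q lt nb with adjSwap-cases i p | adjSwap-cases i q
... | inj₁ (refl , e1) | inj₁ (refl , e2) = ⊥-elim (<-irrefl refl lt)
... | inj₁ (refl , e1) | inj₂ (inj₁ (refl , e2)) = ⊥-elim (nb (refl , refl))
... | inj₁ (refl , e1) | inj₂ (inj₂ (a , b , e2)) = subst₂ _<_ (sym e1) (sym e2) (≤∧≢⇒< lt (λ e → b (sym e)))
... | inj₂ (inj₁ (refl , e1)) | inj₁ (refl , e2) = ⊥-elim (<-asym lt (n<1+n _))
... | inj₂ (inj₁ (refl , e1)) | inj₂ (inj₁ (refl , e2)) = ⊥-elim (<-irrefl refl lt)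
... | inj₂ (inj₁ (refl , e1)) | inj₂ (inj₂ (a , b , e2)) = subst₂ _<_ (sym e1) (sym e2) (<-trans (n<1+n _) lt)
... | inj₂ (inj₂ (a , b , e1)) | inj₁ (refl , e2) = subst₂ _<_ (sym e1) (sym e2) (<-trans lt (n<1+n _))
... | inj₂ (inj₂ (a , b , e1)) | inj₂ (inj₁ (refl , e2)) = subst₂ _<_ (sym e1) (sym e2) (≤∧≢⇒< (≤-pred lt) a)
... | inj₂ (inj₂ (a , b , e1)) | inj₂ (inj₂ (c , d , e2)) = subst₂ _<_ (sym e1) (sym e2) lt

Inversion : (n : ℕ) → Vec ℕ n → ℕ → ℕ → Set
Inversion n τ x y = x < y × Σ ℕ λ p → Σ ℕ λ q → p < q × q < n × nth τ p ≡ y × nth τ q ≡ x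

inversion-cover : ∀ {n τ σ x y} → CoverAt n τ σ → Inversion n τ x y → Inversion n σ x y
inversion-cover {n} {τ} {σ} {x} {y} (i , si , lti , h) (xy , p , q , pq , qn , ey , ex) =
  xy , adjSwap i p , adjSwap i q , adjSwap-<-mono i p q pq nb , adjSwap-< n i q si qn ,
  trans (h (adjSwap i p)) (trans (cong (nth τ) (adjSwap-involutive i p)) ey) ,
  trans (h (adjSwap i q)) (trans (cong (nth τ) (adjSwap-involutive i q)) ex)
  where
  nb : ¬ (p ≡ i × q ≡ suc i)
  nb (refl , refl) = <-asym xy (subst₂ _<_ ey ex lti)

inversion-weakLe : ∀ {n τ σ x y} → Star (Cover n) τ σ → Inversion n τ x y → Inversion n σ x y
inversion-weakLe ε iv = iv
inversion-weakLe {n} {τ} (_◅_ {j = j} c st) iv = inversion-weakLe st (inversion-cover {n} {τ} {j} (Cover⇒CoverAt n τ j c) iv)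

eqb : ℕ → ℕ → Bool
eqb p a = p ≡ᵇ a

eqb-refl : ∀ a → eqb a a ≡ true
eqb-refl zero = refl
eqb-refl (suc a) = eqb-refl a

eqb-≢ : ∀ p a → p ≢ a → eqb p a ≡ false
eqb-≢ zero zero ne = ⊥-elim (ne refl)
eqb-≢ zero (suc a) ne = refl
eqb-≢ (suc p) zero ne = refl
eqb-≢ (suc p) (suc a) ne = eqb-≢ p a (λ e → ne (cong suc e))

eqb⇒≡ : ∀ p a → eqb p a ≡ true → p ≡ a
eqb⇒≡ zero zero e = refl
eqb⇒≡ zero (suc a) ()
eqb⇒≡ (suc p) zero ()
eqb⇒≡ (suc p) (suc a) e = cong suc (eqb⇒≡ p a e)

ltb : ℕ → ℕ → Bool
ltb p zero = false
ltb zero (suc m) = true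
ltb (suc p) (suc m) = ltb p m

<⇒ltb : ∀ p m → p < m → ltb p m ≡ true
<⇒ltb zero (suc m) _ = refl
<⇒ltb (suc p) (suc m) (s≤s lt) = <⇒ltb p m lt

≮⇒ltb : ∀ p m → ¬ p < m → ltb p m ≡ false
≮⇒ltb p zero _ = refl
≮⇒ltb zero (suc m) nl = ⊥-elim (nl (s≤s z≤n))
≮⇒ltb (suc p) (suc m) nl = ≮⇒ltb p m (λ l → nl (s≤s l))

ltb⇒< : ∀ p m → ltb p m ≡ true → p < m
ltb⇒< zero (suc m) _ = s≤s z≤n
ltb⇒< (suc p) (suc m) e = s≤s (ltb⇒< p m e)

ltb-suc : ∀ p m → ltb p (suc m) ≡ ltb p m ∨ eqb p m
ltb-suc zero zero = refl
ltb-suc zero (suc m) = refl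
ltb-suc (suc p) zero = refl
ltb-suc (suc p) (suc m) = ltb-suc p m

ltb-refl : ∀ m → ltb m m ≡ false
ltb-refl zero = refl
ltb-refl (suc m) = ltb-refl m

mark : Marks → ℕ → Marks
mark K' a p = K' p ∨ eqb p a

applySwaps-cong : ∀ n v K1 K2 → (∀ p → K1 p ≡ K2 p) → applySwaps n v K1 ≡ applySwaps n v K2
applySwaps-cong n v K1 K2 h = nth-ext _ _ (λ p lt → trans (nth-tabulateN n _ p lt) (trans
  (cong (nth v) (partner-cong K1 K2 p (h p) (λ p' _ → h p'))) (sym (nth-tabulateN n _ p lt))))

nth-applySwaps : ∀ n v K' p → p < n → nth (applySwaps n v K') p ≡ nth v (partner K' p)
nth-applySwaps n v K' p lt = nth-tabulateN n _ p lt

module AdmissibleSwaps {n : ℕ} {v : Vec ℕ n} {K : Marks} (val : Admissible n v K) where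
  v-injective : InjectiveBelow n (nth v)
  v-injective = proj₂ (proj₁ val)
  marked⇒suc<n : ∀ p → K p ≡ true → suc p < n
  marked⇒suc<n = proj₁ (proj₂ val)
  marked⇒next-unmarked : ∀ p → K p ≡ true → K (suc p) ≡ false
  marked⇒next-unmarked = proj₁ (proj₂ (proj₂ val))
  marked⇒ascent : ∀ p → K p ≡ true → nth v p < nth v (suc p)
  marked⇒ascent = proj₂ (proj₂ (proj₂ val))

  ⊆ₘ-unmarked : ∀ K' → K' ⊆ₘ K → ∀ p → K p ≡ false → K' p ≡ false
  ⊆ₘ-unmarked K' sub p f with K' p in e
  ... | true = ⊥-elim (true≢false (sub p e) f)
  ... | false = refl

  partner-mark : ∀ K' a → K' a ≡ false → K' (suc a) ≡ false → (∀ j → a ≡ suc j → K' j ≡ false) →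
           ∀ p → partner K' (adjSwap a p) ≡ partner (mark K' a) p
  partner-mark K' a f0 f1 fp p with adjSwap-cases a p
  ... | inj₁ (refl , e) = trans (cong (partner K') e) (trans (partner-unmarked K' (suc a) f1 (λ { p' refl → f0 }))
          (sym (partner-marked (mark K' a) a (∨-t' (eqb-refl a)))))
    where ∨-t' : ∀ {b c} → c ≡ true → b ∨ c ≡ true
          ∨-t' {b} refl = ∨-zeroʳ b
  ... | inj₂ (inj₁ (refl , e)) = trans (cong (partner K') e) (trans (partner-unmarked K' a f0 fp)
          (sym (partner-after-marked (mark K' a) a (trans (cong₂ _∨_ f1 (eqb-≢ (suc a) a (λ e → 1+n≢n e))) refl)
                  (trans (cong (K' a ∨_) (eqb-refl a)) (∨-zeroʳ (K' a))))))
  ... | inj₂ (inj₂ (na , nsa , e)) = trans (cong (partner K') e) (partner-cong K' (mark K' a) p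
          (sym (trans (cong (K' p ∨_) (eqb-≢ p a na)) (∨-identityʳ (K' p))))
          (λ { p' refl → sym (trans (cong (K' p' ∨_) (eqb-≢ p' a (λ e' → nsa (cong suc e')))) (∨-identityʳ (K' p'))) }))

  mark-⊆ₘ : ∀ K' a → K' ⊆ₘ K → K a ≡ true → mark K' a ⊆ₘ K
  mark-⊆ₘ K' a sub t p e with K' p in e1
  ... | true = sub p e1
  ... | false = subst (λ z → K z ≡ true) (sym (eqb⇒≡ p a e)) t

  cover-mark : ∀ K' a → K' ⊆ₘ K → K a ≡ true → K' a ≡ false →
              CoverAt n (applySwaps n v K') (applySwaps n v (mark K' a))
  cover-mark K' a sub t f = a , marked⇒suc<n a t , lt , h
    where
    f1 : K' (suc a) ≡ false
    f1 = ⊆ₘ-unmarked K' sub (suc a) (marked⇒next-unmarked a t)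
    fp : ∀ j → a ≡ suc j → K' j ≡ false
    fp j e = ⊆ₘ-unmarked K' sub j (marked⇒prev-unmarked {n} {v} {K} val a j t e)
    lt : nth (applySwaps n v K') a < nth (applySwaps n v K') (suc a)
    lt = subst₂ _<_ (sym (trans (nth-applySwaps n v K' a (≤-trans (n≤1+n _) (marked⇒suc<n a t))) (cong (nth v) (partner-unmarked K' a f fp))))
                    (sym (trans (nth-applySwaps n v K' (suc a) (marked⇒suc<n a t)) (cong (nth v) (partner-unmarked K' (suc a) f1 (λ { _ refl → f })))))
                    (marked⇒ascent a t)
    h : ∀ p → nth (applySwaps n v (mark K' a)) p ≡ nth (applySwaps n v K') (adjSwap a p)
    h p with p <? n
    ... | yes pn = trans (nth-applySwaps n v _ p pn) (trans (cong (nth v) (sym (partner-mark K' a f f1 fp p)))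
                     (sym (nth-applySwaps n v K' (adjSwap a p) (adjSwap-< n a p (marked⇒suc<n a t) pn))))
    ... | no pn = trans (nth-outside (applySwaps n v (mark K' a)) p (≮⇒≥ pn)) (sym (trans (cong (nth (applySwaps n v K'))
                     (adjSwap-other a p (λ e → pn (subst (_< n) (sym e) (≤-trans (n≤1+n _) (marked⇒suc<n a t))))
                                (λ e → pn (subst (_< n) (sym e) (marked⇒suc<n a t)))))
                     (nth-outside (applySwaps n v K') p (≮⇒≥ pn))))

  partner-injective : ∀ K1 K2 → K1 ⊆ₘ K → K2 ⊆ₘ K → ∀ p q → p < n → q < n →
            nth v (partner K1 p) ≡ nth v (partner K2 q) → partner K1 p ≡ partner K2 q
  partner-injective K1 K2 s1 s2 p q pn qn e = v-injective _ _ (partner-< {n} {v} {K} val K1 s1 p pn) (partner-< {n} {v} {K} val K2 s2 q qn) e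

  -- A cover step up from applySwaps n v K' at a position outside K creates an inversion of two
  -- values of v which applySwaps n v K does not have, so it cannot stay below applySwaps n v K.
  unmarked-cover-escapes : ∀ K' τ' → K' ⊆ₘ K → (c : CoverAt n (applySwaps n v K') τ') →
                           Star (Cover n) τ' (applySwaps n v K) → K (proj₁ c) ≡ false → ⊥
  unmarked-cover-escapes K' τ' sub (i , si , lti , h) st unmarked with inversion-weakLe st iv
    where
    τ = applySwaps n v K'
    iv : Inversion n τ' (nth τ i) (nth τ (suc i))
    iv = lti , i , suc i , n<1+n i , si , trans (h i) (cong (nth τ) (adjSwap-left i)) , trans (h (suc i)) (cong (nth τ) (adjSwap-right i))
  ... | _ , p , q , pq , qn , ey , ex = true≢false (subst (λ z → K z ≡ true) p≡i (partner≡suc⇒marked K p partner-p)) unmarked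
    where
    i-unmarked : K' i ≡ false
    i-unmarked = ⊆ₘ-unmarked K' sub i unmarked
    pn = <-trans pq qn
    i<n : i < n
    i<n = ≤-trans (n≤1+n _) si
    eA : partner K p ≡ partner K' (suc i)
    eA = partner-injective K K' (λ _ x → x) sub p (suc i) pn si
           (trans (sym (nth-applySwaps n v K p pn)) (trans ey (nth-applySwaps n v K' (suc i) si)))
    eB : partner K q ≡ partner K' i
    eB = partner-injective K K' (λ _ x → x) sub q i qn i<n
           (trans (sym (nth-applySwaps n v K q qn)) (trans ex (nth-applySwaps n v K' i i<n)))
    suc-i≤ : suc i ≤ partner K' (suc i)
    suc-i≤ with partner K' (suc i) | partnerView K' (suc i)
    ... | ._ | moved-right _ = n≤1+n _
    ... | ._ | moved-left p' refl _ t = ⊥-elim (true≢false t i-unmarked)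
    ... | ._ | fixed _ _ = ≤-refl
    ≤i : partner K' i ≤ i
    ≤i with partner K' i | partnerView K' i
    ... | ._ | moved-right t = ⊥-elim (true≢false t i-unmarked)
    ... | ._ | moved-left p' refl _ _ = n≤1+n _
    ... | ._ | fixed _ _ = ≤-refl
    p≡i : p ≡ i
    p≡i = suc-injective (≤-antisym (≤-trans pq (≤-trans (≤suc-partner K q) (s≤s (≤-trans (≤-reflexive eB) ≤i))))
                                   (≤-trans suc-i≤ (≤-trans (≤-reflexive (sym eA)) (partner≤suc K p))))
    partner-p : partner K p ≡ suc p
    partner-p = ≤-antisym (partner≤suc K p) (≤-trans (≤-reflexive (cong suc p≡i)) (≤-trans suc-i≤ (≤-reflexive (sym eA))))

  cover-is-mark : ∀ K' τ' → K' ⊆ₘ K → CoverAt n (applySwaps n v K') τ' → Star (Cover n) τ' (applySwaps n v K) →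
                  Σ ℕ λ a → K a ≡ true × K' a ≡ false × τ' ≡ applySwaps n v (mark K' a)
  cover-is-mark K' τ' sub c@(i , si , lti , h) st with K i in eK | K' i in eK'
  ... | true | true = ⊥-elim (<-asym (subst₂ _<_ l0 l1 lti) (marked⇒ascent i eK))
    where
    l0 : nth (applySwaps n v K') i ≡ nth v (suc i)
    l0 = trans (nth-applySwaps n v K' i (≤-trans (n≤1+n _) si)) (cong (nth v) (partner-marked K' i eK'))
    l1 : nth (applySwaps n v K') (suc i) ≡ nth v i
    l1 = trans (nth-applySwaps n v K' (suc i) si) (cong (nth v) (partner-after-marked K' i (⊆ₘ-unmarked K' sub (suc i) (marked⇒next-unmarked i eK)) eK'))
  ... | true | false = i , eK , eK' , nth-ext _ _ (λ p _ → trans (h p)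
          (sym (proj₂ (proj₂ (proj₂ (cover-mark K' i sub eK eK'))) p)))
  ... | false | _ = ⊥-elim (unmarked-cover-escapes K' τ' sub c st eK)

  weakLe⇒⊆ₘ : ∀ K1 K2 → K1 ⊆ₘ K → K2 ⊆ₘ K → Star (Cover n) (applySwaps n v K1) (applySwaps n v K2) → K1 ⊆ₘ K2
  weakLe⇒⊆ₘ K1 K2 s1 s2 st a t1 with K2 a in e2
  ... | true = refl
  ... | false = ⊥-elim contra
    where
    tK = s1 a t1
    sa = marked⇒suc<n a tK
    an = ≤-trans (n≤1+n _) sa
    τ = applySwaps n v K1
    l0 : nth τ a ≡ nth v (suc a)
    l0 = trans (nth-applySwaps n v K1 a an) (cong (nth v) (partner-marked K1 a t1))
    l1 : nth τ (suc a) ≡ nth v a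
    l1 = trans (nth-applySwaps n v K1 (suc a) sa) (cong (nth v) (partner-after-marked K1 a (⊆ₘ-unmarked K1 s1 (suc a) (marked⇒next-unmarked a tK)) t1))
    iv : Inversion n τ (nth v a) (nth v (suc a))
    iv = marked⇒ascent a tK , a , suc a , n<1+n a , sa , l0 , l1
    contra : ⊥
    contra with inversion-weakLe st iv
    ... | _ , p , q , pq , qn , ey , ex = <-asym pq (subst₂ _<_ qa pa (n<1+n a))
      where
      pn = <-trans pq qn
      eP : partner K2 p ≡ suc a
      eP = v-injective _ _ (partner-< {n} {v} {K} val K2 s2 p pn) sa (trans (sym (nth-applySwaps n v K2 p pn)) ey)
      eQ : partner K2 q ≡ a
      eQ = v-injective _ _ (partner-< {n} {v} {K} val K2 s2 q qn) an (trans (sym (nth-applySwaps n v K2 q qn)) ex)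
      pa : suc a ≡ p
      pa with partner K2 p | partnerView K2 p | eP
      ... | ._ | moved-right t | e' = ⊥-elim (true≢false (subst (λ z → K2 z ≡ true) (suc-injective e') t) e2)
      ... | ._ | moved-left p' refl _ t | e' = ⊥-elim (true≢false (s2 _ (subst (λ z → K2 z ≡ true) e' t)) (marked⇒next-unmarked a tK))
      ... | ._ | fixed _ _ | e' = sym e'
      qa : a ≡ q
      qa with partner K2 q | partnerView K2 q | eQ
      ... | ._ | moved-right t | e' = ⊥-elim (true≢false (subst (λ z → K z ≡ true) (sym e') tK) (marked⇒next-unmarked q (s2 q t)))
      ... | ._ | moved-left p' refl _ t | e' = ⊥-elim (true≢false (subst (λ z → K2 z ≡ true) e' t) e2)
      ... | ._ | fixed _ _ | e' = sym e'

  module MarkChain (K1 K2 : Marks) (s12 : K1 ⊆ₘ K2) (s2 : K2 ⊆ₘ K) where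
    marksBelow : ℕ → Marks
    marksBelow m p = K1 p ∨ (K2 p ∧ ltb p m)

    marksBelow-⊆ₘ : ∀ m → marksBelow m ⊆ₘ K
    marksBelow-⊆ₘ m p e with K1 p in e1 | K2 p in e2
    ... | true | _ = s2 p (s12 p e1)
    ... | false | true = s2 p e2
    ... | false | false = ⊥-elim (true≢false e refl)

    step : ∀ m → Star (Cover n) (applySwaps n v (marksBelow m)) (applySwaps n v (marksBelow (suc m)))
    step m with K1 m in e1 | K2 m in e2
    ... | false | true = subst (Star (Cover n) (applySwaps n v (marksBelow m))) (applySwaps-cong n v _ _ pw)
                          (CoverAt⇒Cover n _ _ (cover-mark (marksBelow m) m (marksBelow-⊆ₘ m) (s2 m e2) km) ◅ ε)
      where
      km : marksBelow m m ≡ false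
      km rewrite e1 | e2 | ltb-refl m = refl
      pw : ∀ p → mark (marksBelow m) m p ≡ marksBelow (suc m) p
      pw p with p ≟ m
      ... | yes refl rewrite e1 | e2 | ltb-suc m m | ltb-refl m | eqb-refl m = refl
      ... | no ne rewrite ltb-suc p m | eqb-≢ p m ne | ∨-identityʳ (ltb p m) = ∨-identityʳ _
    ... | true | _ = subst (Star (Cover n) (applySwaps n v (marksBelow m))) (applySwaps-cong n v _ _ pw) ε
      where
      pw : ∀ p → marksBelow m p ≡ marksBelow (suc m) p
      pw p with p ≟ m
      ... | yes refl rewrite e1 = refl
      ... | no ne rewrite ltb-suc p m | eqb-≢ p m ne | ∨-identityʳ (ltb p m) = refl
    ... | false | false = subst (Star (Cover n) (applySwaps n v (marksBelow m))) (applySwaps-cong n v _ _ pw) ε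
      where
      pw : ∀ p → marksBelow m p ≡ marksBelow (suc m) p
      pw p with p ≟ m
      ... | yes refl rewrite e1 | e2 = refl
      ... | no ne rewrite ltb-suc p m | eqb-≢ p m ne | ∨-identityʳ (ltb p m) = refl

    chainBelow : ∀ m → Star (Cover n) (applySwaps n v (marksBelow 0)) (applySwaps n v (marksBelow m))
    chainBelow zero = ε
    chainBelow (suc m) = chainBelow m ◅◅ step m

    chain : Star (Cover n) (applySwaps n v K1) (applySwaps n v K2)
    chain = subst₂ (Star (Cover n)) (applySwaps-cong n v _ _ p0) (applySwaps-cong n v _ _ pn) (chainBelow n)
      where
      p0 : ∀ p → marksBelow 0 p ≡ K1 p
      p0 p with K2 p
      ... | true = ∨-identityʳ (K1 p)
      ... | false = ∨-identityʳ (K1 p)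
      pn : ∀ p → marksBelow n p ≡ K2 p
      pn p with K2 p in e2
      ... | true rewrite <⇒ltb p n (≤-trans (n≤1+n _) (marked⇒suc<n p (s2 p e2))) = ∨-zeroʳ (K1 p)
      ... | false with K1 p in e1
      ...   | true = ⊥-elim (true≢false (s12 p e1) e2)
      ...   | false = refl

  ⊆ₘ⇒weakLe : ∀ K1 K2 → K1 ⊆ₘ K2 → K2 ⊆ₘ K → Star (Cover n) (applySwaps n v K1) (applySwaps n v K2)
  ⊆ₘ⇒weakLe K1 K2 s12 s2 = MarkChain.chain K1 K2 s12 s2

-- Admissible swap sets give Boolean intervals

Enumeration : Marks → ℕ → ℕ → Set
Enumeration K n c = Σ (ℕ → ℕ) λ e → (∀ t → t < c → e t < n × K (e t) ≡ true) × InjectiveBelow c e ×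
  (∀ p → p < n → K p ≡ true → Σ ℕ λ t → t < c × e t ≡ p)

enumerate : ∀ K n → Enumeration K n (count n K)
enumerate K zero = (λ _ → 0) , (λ t ()) , (λ p q ()) , (λ p ())
enumerate K (suc n) with enumerate K n | K n in eKn
... | e , r , inj , sur | false = subst (Enumeration K (suc n)) (sym (+-identityʳ _))
      (e , (λ t lt → let (a , b) = r t lt in m≤n⇒m≤1+n a , b) , inj ,
       λ p lt kp → case (p ≟ n) lt kp)
  where
  case : ∀ {p} → Dec (p ≡ n) → p < suc n → K p ≡ true → Σ ℕ λ t → t < count n K × e t ≡ p
  case (yes refl) _ kp = ⊥-elim (true≢false kp eKn)
  case (no ne) lt kp = sur _ (≤∧≢⇒< (≤-pred lt) ne) kp
... | e , r , inj , sur | true = subst (Enumeration K (suc n)) (+-comm 1 (count n K)) (e' , r' , inj' , sur')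
  where
  c = count n K
  e' : ℕ → ℕ
  e' t with t ≟ c
  ... | yes _ = n
  ... | no _ = e t
  e'c : e' c ≡ n
  e'c with c ≟ c
  ... | yes _ = refl
  ... | no ne = ⊥-elim (ne refl)
  e'o : ∀ t → t ≢ c → e' t ≡ e t
  e'o t ne with t ≟ c
  ... | yes e = ⊥-elim (ne e)
  ... | no _ = refl
  split : ∀ t → t < suc c → (t ≡ c) ⊎ (t < c)
  split t lt with t ≟ c
  ... | yes e = inj₁ e
  ... | no ne = inj₂ (≤∧≢⇒< (≤-pred lt) ne)
  r' : ∀ t → t < suc c → e' t < suc n × K (e' t) ≡ true
  r' t lt with split t lt
  ... | inj₁ refl = subst (_< suc n) (sym e'c) ≤-refl , subst (λ z → K z ≡ true) (sym e'c) eKn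
  ... | inj₂ l = subst (_< suc n) (sym (e'o t (<⇒≢ l))) (m≤n⇒m≤1+n (proj₁ (r t l))) ,
                 subst (λ z → K z ≡ true) (sym (e'o t (<⇒≢ l))) (proj₂ (r t l))
  inj' : InjectiveBelow (suc c) e'
  inj' p q lp lq eq with split p lp | split q lq
  ... | inj₁ a | inj₁ b = trans a (sym b)
  ... | inj₁ refl | inj₂ b = ⊥-elim (<-irrefl (sym (trans (sym e'c) (trans eq (e'o q (<⇒≢ b))))) (proj₁ (r q b)))
  ... | inj₂ a | inj₁ refl = ⊥-elim (<-irrefl (sym (trans (sym e'c) (trans (sym eq) (e'o p (<⇒≢ a))))) (proj₁ (r p a)))
  ... | inj₂ a | inj₂ b = inj p q a b (trans (sym (e'o p (<⇒≢ a))) (trans eq (e'o q (<⇒≢ b))))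
  sur' : ∀ p → p < suc n → K p ≡ true → Σ ℕ λ t → t < suc c × e' t ≡ p
  sur' p lt kp with p ≟ n
  ... | yes refl = c , ≤-refl , e'c
  ... | no ne with sur p (≤∧≢⇒< (≤-pred lt) ne) kp
  ...   | t , l , et = t , m≤n⇒m≤1+n l , trans (e'o t (<⇒≢ l)) et

nthᵇ : ∀ {k} → Vec Bool k → ℕ → Bool
nthᵇ = nthOr false

nthᵇ-tabulateN : ∀ k h p → p < k → nthᵇ (tabulateN k h) p ≡ h p
nthᵇ-tabulateN = nthOr-tabulateN false

nthᵇ-ext : ∀ {k} (u v : Vec Bool k) → (∀ p → p < k → nthᵇ u p ≡ nthᵇ v p) → u ≡ v
nthᵇ-ext = nthOr-ext false

∈⇒nthᵇ : ∀ {k} (S : Subset k) (x : Fin k) → x ∈ₛ S → nthᵇ S (toℕ x) ≡ true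
∈⇒nthᵇ S x m = trans (sym (lookup≡nthOr false S x)) ([]=⇒lookup m)

nthᵇ⇒∈ : ∀ {k} (S : Subset k) (x : Fin k) → nthᵇ S (toℕ x) ≡ true → x ∈ₛ S
nthᵇ⇒∈ S x e = lookup⇒[]= x S (trans (lookup≡nthOr false S x) e)

anyBelow : ℕ → (ℕ → Bool) → Bool
anyBelow zero h = false
anyBelow (suc k) h = anyBelow k h ∨ h k

anyBelow⇒∃ : ∀ k h → anyBelow k h ≡ true → Σ ℕ λ t → t < k × h t ≡ true
anyBelow⇒∃ zero h ()
anyBelow⇒∃ (suc k) h e with anyBelow k h in e1 | h k in e2
... | true | _ = let (t , l , x) = anyBelow⇒∃ k h e1 in t , m≤n⇒m≤1+n l , x
... | false | true = k , ≤-refl , e2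
... | false | false = ⊥-elim (true≢false e refl)

∃⇒anyBelow : ∀ k h t → t < k → h t ≡ true → anyBelow k h ≡ true
∃⇒anyBelow (suc k) h t lt ht with t ≟ k
... | yes refl rewrite ht = ∨-zeroʳ (anyBelow k h)
... | no ne rewrite ∃⇒anyBelow k h t (≤∧≢⇒< (≤-pred lt) ne) ht = refl

⇔⇒≡ : ∀ {b c : Bool} → (b ≡ true → c ≡ true) → (c ≡ true → b ≡ true) → b ≡ c
⇔⇒≡ {true} {true} f g = refl
⇔⇒≡ {true} {false} f g = sym (f refl)
⇔⇒≡ {false} {true} f g = g refl
⇔⇒≡ {false} {false} f g = refl

∧-true⁻ : ∀ {a b} → a ∧ b ≡ true → a ≡ true × b ≡ true
∧-true⁻ {true} {true} _ = refl , refl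

noMarks : Marks
noMarks _ = false

applySwaps-noMarks : ∀ n (v : Vec ℕ n) → v ≡ applySwaps n v noMarks
applySwaps-noMarks n v = nth-ext _ _ (λ p lt → sym (trans (nth-applySwaps n v noMarks p lt) (cong (nth v) (partner-unmarked noMarks p refl (λ _ _ → refl)))))

applySwaps-isPerm : ∀ {n v K} → Admissible n v K → IsPerm n (applySwaps n v K)
applySwaps-isPerm {n} {v} {K} val = PermAt⇒IsPerm n _ (rng , inj)
  where
  open AdmissibleSwaps {n} {v} {K} val
  rng : ∀ p → p < n → 1 ≤ nth (applySwaps n v K) p × nth (applySwaps n v K) p ≤ n
  rng p lt = subst (λ z → 1 ≤ z × z ≤ n) (sym (nth-applySwaps n v K p lt)) (proj₁ (proj₁ val) _ (partner-< {n} {v} {K} val K (λ _ x → x) p lt))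
  inj : InjectiveBelow n (nth (applySwaps n v K))
  inj p q lp lq eq = trans (sym (partner-involutive {n} {v} {K} val K (λ _ x → x) p)) (trans (cong (partner K) e1) (partner-involutive {n} {v} {K} val K (λ _ x → x) q))
    where
    e1 : partner K p ≡ partner K q
    e1 = v-injective _ _ (partner-< {n} {v} {K} val K (λ _ x → x) p lp) (partner-< {n} {v} {K} val K (λ _ x → x) q lq)
           (trans (sym (nth-applySwaps n v K p lp)) (trans eq (nth-applySwaps n v K q lq)))

module IntervalOfSwaps {n k : ℕ} {v : Vec ℕ n} {K : Marks} (val : Admissible n v K) (ck : count n K ≡ k) where
  open AdmissibleSwaps {n} {v} {K} val
  enumeration : Enumeration K n k
  enumeration = subst (Enumeration K n) ck (enumerate K n)
  enum : ℕ → ℕ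
  enum = proj₁ enumeration
  enum-marked : ∀ t → t < k → enum t < n × K (enum t) ≡ true
  enum-marked = proj₁ (proj₂ enumeration)
  enum-injective : InjectiveBelow k enum
  enum-injective = proj₁ (proj₂ (proj₂ enumeration))
  enum-onto : ∀ p → p < n → K p ≡ true → Σ ℕ λ t → t < k × enum t ≡ p
  enum-onto = proj₂ (proj₂ (proj₂ enumeration))

  marksOf : Subset k → Marks
  marksOf S p = anyBelow k (λ t → nthᵇ S t ∧ eqb (enum t) p)

  marksOf-⊆ₘ : ∀ S → marksOf S ⊆ₘ K
  marksOf-⊆ₘ S p h with anyBelow⇒∃ k _ h
  ... | t , lt , x = subst (λ z → K z ≡ true) (eqb⇒≡ _ _ (proj₂ (∧-true⁻ {nthᵇ S t} x))) (proj₂ (enum-marked t lt))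

  marksOf-enum : ∀ S t → t < k → marksOf S (enum t) ≡ nthᵇ S t
  marksOf-enum S t lt = ⇔⇒≡ to from
    where
    to : marksOf S (enum t) ≡ true → nthᵇ S t ≡ true
    to h with anyBelow⇒∃ k _ h
    ... | t' , lt' , x = subst (λ z → nthᵇ S z ≡ true) (enum-injective t' t lt' lt (eqb⇒≡ _ _ (proj₂ (∧-true⁻ {nthᵇ S t'} x))))
                           (proj₁ (∧-true⁻ {nthᵇ S t'} x))
    from : nthᵇ S t ≡ true → marksOf S (enum t) ≡ true
    from h = ∃⇒anyBelow k _ t lt (subst (λ z → z ∧ eqb (enum t) (enum t) ≡ true) (sym h) (eqb-refl (enum t)))

  decode : Subset k → Vec ℕ n
  decode S = applySwaps n v (marksOf S)
  code : Vec ℕ n → Subset k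
  code u = tabulateN k (λ t → not (eqb (nth u (enum t)) (nth v (enum t))))

  code-bit : ∀ K' → K' ⊆ₘ K → ∀ t → t < k → not (eqb (nth (applySwaps n v K') (enum t)) (nth v (enum t))) ≡ K' (enum t)
  code-bit K' sub t lt with K' (enum t) in eK'
  ... | true = cong not (eqb-≢ _ _ (λ eq → 1+n≢n (v-injective _ _ (marked⇒suc<n (enum t) kt) (proj₁ (enum-marked t lt))
                   (trans (sym (cong (nth v) (partner-marked K' (enum t) eK'))) (trans (sym (nth-applySwaps n v K' (enum t) (proj₁ (enum-marked t lt)))) eq)))))
    where
    kt = proj₂ (enum-marked t lt)
  ... | false = cong not (trans (cong (λ z → eqb z (nth v (enum t)))
                  (trans (nth-applySwaps n v K' (enum t) (proj₁ (enum-marked t lt))) (cong (nth v) (partner-unmarked K' (enum t) eK'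
                     (λ p' eq → ⊆ₘ-unmarked K' sub p' (marked⇒prev-unmarked {n} {v} {K} val (enum t) p' (proj₂ (enum-marked t lt)) eq))))))
                  (eqb-refl (nth v (enum t))))

  code-applySwaps : ∀ K' → K' ⊆ₘ K → ∀ t → t < k → nthᵇ (code (applySwaps n v K')) t ≡ K' (enum t)
  code-applySwaps K' sub t lt = trans (nthᵇ-tabulateN k _ t lt) (code-bit K' sub t lt)

  marksOf-code : ∀ K' → K' ⊆ₘ K → ∀ p → marksOf (code (applySwaps n v K')) p ≡ K' p
  marksOf-code K' sub p = ⇔⇒≡ to from
    where
    to : marksOf (code (applySwaps n v K')) p ≡ true → K' p ≡ true
    to h with anyBelow⇒∃ k _ h
    ... | t , lt , x = subst (λ z → K' z ≡ true) (eqb⇒≡ _ _ (proj₂ (∧-true⁻ {nthᵇ (code (applySwaps n v K')) t} x)))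
                         (trans (sym (code-applySwaps K' sub t lt)) (proj₁ (∧-true⁻ {nthᵇ (code (applySwaps n v K')) t} x)))
    from : K' p ≡ true → marksOf (code (applySwaps n v K')) p ≡ true
    from h with enum-onto p (≤-trans (n≤1+n _) (marked⇒suc<n p (sub p h))) (sub p h)
    ... | t , lt , et = ∃⇒anyBelow k _ t lt (subst₂ (λ a b → a ∧ b ≡ true) (sym (trans (code-applySwaps K' sub t lt) (cong K' et)))
                           (sym (trans (cong (λ z → eqb z p) et) (eqb-refl p))) (subst (λ z → z ∧ true ≡ true) (sym h) refl))

  code-decode : ∀ S → code (decode S) ≡ S
  code-decode S = nthᵇ-ext _ _ (λ t lt → trans (code-applySwaps (marksOf S) (marksOf-⊆ₘ S) t lt) (marksOf-enum S t lt))

  w : Vec ℕ n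
  w = applySwaps n v K

  interval-applySwaps : ∀ K' τ0 τ → K' ⊆ₘ K → τ0 ≡ applySwaps n v K' → Star (Cover n) τ0 τ → Star (Cover n) τ w →
        Σ Marks λ K'' → K'' ⊆ₘ K × τ ≡ applySwaps n v K''
  interval-applySwaps K' τ0 τ sub eq0 ε _ = K' , sub , eq0
  interval-applySwaps K' τ0 τ sub refl (_◅_ {j = y} c st) st2 with cover-is-mark K' y sub (Cover⇒CoverAt n _ _ c) (st ◅◅ st2)
  ... | a , ka , _ , eq = interval-applySwaps (mark K' a) y τ (mark-⊆ₘ K' a sub ka) eq st st2

  inInterval⇒applySwaps : ∀ u → InInterval n v w u → Σ Marks λ K' → K' ⊆ₘ K × u ≡ applySwaps n v K'
  inInterval⇒applySwaps u (s1 , s2) = interval-applySwaps noMarks v u (λ _ ()) (applySwaps-noMarks n v) s1 s2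

  decode-code : ∀ u → InInterval n v w u → decode (code u) ≡ u
  decode-code u iu with inInterval⇒applySwaps u iu
  ... | K' , sub , refl = applySwaps-cong n v _ _ (marksOf-code K' sub)

  decode-inInterval : ∀ S → InInterval n v w (decode S)
  decode-inInterval S = subst (λ z → Star (Cover n) z (decode S)) (sym (applySwaps-noMarks n v)) (⊆ₘ⇒weakLe noMarks (marksOf S) (λ _ ()) (marksOf-⊆ₘ S)) ,
         ⊆ₘ⇒weakLe (marksOf S) K (marksOf-⊆ₘ S) (λ _ x → x)

  weakLe⇔code-⊆ : ∀ u u' → InInterval n v w u → InInterval n v w u' → (WeakLe n u u' ⇔ code u ⊆ code u')
  weakLe⇔code-⊆ u u' iu iu' with inInterval⇒applySwaps u iu | inInterval⇒applySwaps u' iu'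
  ... | K1 , s1 , refl | K2 , s2 , refl = mk⇔ to from
    where
    to : WeakLe n (applySwaps n v K1) (applySwaps n v K2) → code (applySwaps n v K1) ⊆ code (applySwaps n v K2)
    to st {x} m = nthᵇ⇒∈ _ x (trans (code-applySwaps K2 s2 (toℕ x) (Finₚ.toℕ<n x))
                   (weakLe⇒⊆ₘ K1 K2 s1 s2 st _ (trans (sym (code-applySwaps K1 s1 (toℕ x) (Finₚ.toℕ<n x))) (∈⇒nthᵇ _ x m))))
    from : code (applySwaps n v K1) ⊆ code (applySwaps n v K2) → WeakLe n (applySwaps n v K1) (applySwaps n v K2)
    from sb = ⊆ₘ⇒weakLe K1 K2 s12 s2
      where
      s12 : K1 ⊆ₘ K2
      s12 p h with enum-onto p (≤-trans (n≤1+n _) (marked⇒suc<n p (s1 p h))) (s1 p h)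
      ... | t , lt , refl = trans (sym (code-applySwaps K2 s2 t lt)) (trans (cong (nthᵇ (code (applySwaps n v K2))) (sym tt))
            (∈⇒nthᵇ (code (applySwaps n v K2)) x (sb (nthᵇ⇒∈ (code (applySwaps n v K1)) x (trans (cong (nthᵇ (code (applySwaps n v K1))) tt) (trans (code-applySwaps K1 s1 t lt) h))))))
        where
        x = Fin.fromℕ< lt
        tt : toℕ x ≡ t
        tt = Finₚ.toℕ-fromℕ< lt

  isBooleanInterval : IsBooleanInterval n k (v , w)
  isBooleanInterval = v-perm , applySwaps-isPerm {n} {v} {K} val ,
           subst (λ z → Star (Cover n) z w) (sym (applySwaps-noMarks n v)) (⊆ₘ⇒weakLe noMarks K (λ _ ()) (λ _ x → x)) ,
           code , decode , decode-inInterval , code-decode , decode-code , weakLe⇔code-⊆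
    where
    v-perm : IsPerm n v
    v-perm = PermAt⇒IsPerm n v (proj₁ val)

-- Every Boolean interval comes from an admissible swap set

swapsBetween : (n : ℕ) → Vec ℕ n → Vec ℕ n → Marks
swapsBetween n v w p = ltb (suc p) n ∧ eqb (nth w p) (nth v (suc p))

swapsBetween-applySwaps : ∀ {n v K} → Admissible n v K → ∀ p → swapsBetween n v (applySwaps n v K) p ≡ K p
swapsBetween-applySwaps {n} {v} {K} val p = ⇔⇒≡ to fr
  where
  open AdmissibleSwaps {n} {v} {K} val
  to : swapsBetween n v (applySwaps n v K) p ≡ true → K p ≡ true
  to h with ∧-true⁻ {ltb (suc p) n} h
  ... | h1 , h2 = partner≡suc⇒marked K p (v-injective _ _ (partner-< {n} {v} {K} val K (λ _ x → x) p pn) sn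
        (trans (sym (nth-applySwaps n v K p pn)) (eqb⇒≡ _ _ h2)))
    where
    sn = ltb⇒< (suc p) n h1
    pn = ≤-trans (n≤1+n _) sn
  fr : K p ≡ true → swapsBetween n v (applySwaps n v K) p ≡ true
  fr h = subst₂ (λ a b → a ∧ b ≡ true) (sym (<⇒ltb (suc p) n sn))
           (sym (subst (λ z → eqb z (nth v (suc p)) ≡ true) (sym (trans (nth-applySwaps n v K p pn) (cong (nth v) (partner-marked K p h))))
             (eqb-refl (nth v (suc p)))))
           refl
    where
    sn = marked⇒suc<n p h
    pn = ≤-trans (n≤1+n _) sn

⊆⇒nthᵇ : ∀ {k} (S S' : Subset k) → S ⊆ S' → ∀ t → t < k → nthᵇ S t ≡ true → nthᵇ S' t ≡ true
⊆⇒nthᵇ S S' sb t lt h = trans (cong (nthᵇ S') (sym tt)) (∈⇒nthᵇ S' x (sb (nthᵇ⇒∈ S x (trans (cong (nthᵇ S) tt) h))))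
  where
  x = Fin.fromℕ< lt
  tt : toℕ x ≡ t
  tt = Finₚ.toℕ-fromℕ< lt

cover-irreflexive : ∀ {n τ} → CoverAt n τ τ → ⊥
cover-irreflexive {n} {τ} (i , _ , lt , h) = <-irrefl (trans (h i) (cong (nth τ) (adjSwap-left i))) lt

cover-injective : ∀ {n τ σ} → CoverAt n τ σ → InjectiveBelow n (nth τ) → InjectiveBelow n (nth σ)
cover-injective {n} {τ} {σ} (i , si , _ , h) inj p q lp lq e =
  trans (sym (adjSwap-involutive i p)) (trans (cong (adjSwap i) (inj _ _ (adjSwap-< n i p si lp) (adjSwap-< n i q si lq)
    (trans (sym (h p)) (trans e (h q))))) (adjSwap-involutive i q))

weakLe-injective : ∀ {n τ σ} → Star (Cover n) τ σ → InjectiveBelow n (nth τ) → InjectiveBelow n (nth σ)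
weakLe-injective ε inj = inj
weakLe-injective {n} {τ} (_◅_ {j = y} c st) inj = weakLe-injective st (cover-injective {n} {τ} {y} (Cover⇒CoverAt n τ y c) inj)

new-inversion : ∀ {n τ σ x y} → (c : CoverAt n τ σ) → Inversion n σ x y → ¬ Inversion n τ x y →
          nth τ (proj₁ c) ≡ x × nth τ (suc (proj₁ c)) ≡ y
new-inversion {n} {τ} {σ} {x} {y} (i , si , lti , h) (xy , p , q , pq , qn , ey , ex) ni with p ≟ i | q ≟ suc i
... | yes refl | yes refl = trans (sym (trans (h q) (cong (nth τ) (adjSwap-right i)))) ex , trans (sym (trans (h p) (cong (nth τ) (adjSwap-left i)))) ey
... | no a | _ = ⊥-elim (ni (xy , adjSwap i p , adjSwap i q , adjSwap-<-mono i p q pq (λ { (e , _) → a e }) , adjSwap-< n i q si qn ,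
                      trans (sym (h p)) ey , trans (sym (h q)) ex))
... | yes _ | no b = ⊥-elim (ni (xy , adjSwap i p , adjSwap i q , adjSwap-<-mono i p q pq (λ { (_ , e) → b e }) , adjSwap-< n i q si qn ,
                      trans (sym (h p)) ey , trans (sym (h q)) ex))

inversion-trans : ∀ {n τ x y z} → InjectiveBelow n (nth τ) → Inversion n τ x y → Inversion n τ y z → Inversion n τ x z
inversion-trans inj (xy , p1 , q1 , pq1 , qn1 , ey , ex) (yz , p2 , q2 , pq2 , qn2 , ez , ey') =
  <-trans xy yz , p2 , q1 , <-trans pq2 (subst (_< q1) (inj _ _ (<-trans pq1 qn1) qn2 (trans ey (sym ey'))) pq1) , qn1 , ez , ex

-- The atoms of [v, w] are covers v ⋖ v sₐ. Two atoms at adjacent positions a, a + 1 are impossible: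
-- above both of them the values at positions a, a + 1, a + 2 of v would be fully reversed, which
-- no single cover of v sₐ achieves. So the atom positions form an admissible set, and adding atoms
-- one at a time identifies the element coded by S with applySwaps over the atoms in S.
module SwapsOfInterval {n k : ℕ} {v w : Vec ℕ n} (bi : IsBooleanInterval n k (v , w)) where
  v-perm : IsPerm n v
  v-perm = proj₁ bi
  v≤w : WeakLe n v w
  v≤w = proj₁ (proj₂ (proj₂ bi))
  boolean : IsBooleanOfRank n k v w
  boolean = proj₂ (proj₂ (proj₂ bi))
  code : Vec ℕ n → Subset k
  code = proj₁ boolean
  decode : Subset k → Vec ℕ n
  decode = proj₁ (proj₂ boolean)
  decode-inInterval : ∀ S → InInterval n v w (decode S)
  decode-inInterval = proj₁ (proj₂ (proj₂ boolean))
  code-decode : ∀ S → code (decode S) ≡ S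
  code-decode = proj₁ (proj₂ (proj₂ (proj₂ boolean)))
  decode-code : ∀ u → InInterval n v w u → decode (code u) ≡ u
  decode-code = proj₁ (proj₂ (proj₂ (proj₂ (proj₂ boolean))))
  weakLe⇔code-⊆ : ∀ u u' → InInterval n v w u → InInterval n v w u' → (WeakLe n u u' ⇔ code u ⊆ code u')
  weakLe⇔code-⊆ = proj₂ (proj₂ (proj₂ (proj₂ (proj₂ boolean))))
  v-permAt : PermAt n v
  v-permAt = IsPerm⇒PermAt n v v-perm
  v-injective : InjectiveBelow n (nth v)
  v-injective = proj₂ v-permAt

  weakLe⇒code-⊆ : ∀ u u' → InInterval n v w u → InInterval n v w u' → WeakLe n u u' → code u ⊆ code u'
  weakLe⇒code-⊆ u u' iu iu' = Equivalence.to (weakLe⇔code-⊆ u u' iu iu')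
  code-⊆⇒weakLe : ∀ u u' → InInterval n v w u → InInterval n v w u' → code u ⊆ code u' → WeakLe n u u'
  code-⊆⇒weakLe u u' iu iu' = Equivalence.from (weakLe⇔code-⊆ u u' iu iu')

  v∈[v,w] : InInterval n v w v
  v∈[v,w] = ε , v≤w
  w∈[v,w] : InInterval n v w w
  w∈[v,w] = v≤w , ε

  ∅S ⊤S : Subset k
  ∅S = tabulateN k (λ _ → false)
  ⊤S = tabulateN k (λ _ → true)
  insert : Subset k → ℕ → Subset k
  insert S t = tabulateN k (λ t' → nthᵇ S t' ∨ eqb t' t)

  decode-∅ : decode ∅S ≡ v
  decode-∅ = trans (cong decode (sym code-v)) (decode-code v v∈[v,w])
    where
    code-v : code v ≡ ∅S
    code-v = nthᵇ-ext _ _ (λ t lt → h t lt)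
      where
      h : ∀ t → t < k → nthᵇ (code v) t ≡ nthᵇ ∅S t
      h t lt with nthᵇ (code v) t in e
      ... | true = ⊥-elim (true≢false (⊆⇒nthᵇ (code v) ∅S (subst (code v ⊆_) (code-decode ∅S) (weakLe⇒code-⊆ v (decode ∅S) v∈[v,w] (decode-inInterval ∅S) (proj₁ (decode-inInterval ∅S)))) t lt e)
                                (nthᵇ-tabulateN k _ t lt))
      ... | false = sym (nthᵇ-tabulateN k _ t lt)

  decode-⊤ : decode ⊤S ≡ w
  decode-⊤ = trans (cong decode (sym code-w)) (decode-code w w∈[v,w])
    where
    code-w : code w ≡ ⊤S
    code-w = nthᵇ-ext _ _ (λ t lt → h t lt)
      where
      h : ∀ t → t < k → nthᵇ (code w) t ≡ nthᵇ ⊤S t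
      h t lt with nthᵇ (code w) t in e
      ... | true = sym (nthᵇ-tabulateN k _ t lt)
      ... | false = ⊥-elim (true≢false (⊆⇒nthᵇ ⊤S (code w) (subst (_⊆ code w) (code-decode ⊤S) (weakLe⇒code-⊆ (decode ⊤S) w (decode-inInterval ⊤S) w∈[v,w] (proj₂ (decode-inInterval ⊤S)))) t lt
                                (nthᵇ-tabulateN k _ t lt)) e)

  decode-mono : ∀ S S' → (∀ t → t < k → nthᵇ S t ≡ true → nthᵇ S' t ≡ true) → WeakLe n (decode S) (decode S')
  decode-mono S S' h = code-⊆⇒weakLe (decode S) (decode S') (decode-inInterval S) (decode-inInterval S') (λ {x} m → subst (x ∈ₛ_) (sym (code-decode S'))
      (nthᵇ⇒∈ S' x (h (toℕ x) (Finₚ.toℕ<n x) (∈⇒nthᵇ S x (subst (x ∈ₛ_) (code-decode S) m)))))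

  nthᵇ-insert : ∀ S t t' → t' < k → nthᵇ (insert S t) t' ≡ nthᵇ S t' ∨ eqb t' t
  nthᵇ-insert S t t' lt = nthᵇ-tabulateN k _ t' lt

  decode-insert-cover : ∀ S t → t < k → nthᵇ S t ≡ false → CoverAt n (decode S) (decode (insert S t))
  decode-insert-cover S t tk nt = go (decode S') (decode-mono S S' incl) refl
    where
    S' = insert S t
    incl : ∀ t' → t' < k → nthᵇ S t' ≡ true → nthᵇ S' t' ≡ true
    incl t' lt h rewrite nthᵇ-insert S t t' lt | h = refl
    S't : nthᵇ S' t ≡ true
    S't = trans (nthᵇ-insert S t t tk) (trans (cong (nthᵇ S t ∨_) (eqb-refl t)) (∨-zeroʳ (nthᵇ S t)))
    S'o : ∀ t' → t' < k → t' ≢ t → nthᵇ S' t' ≡ nthᵇ S t'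
    S'o t' lt ne = trans (nthᵇ-insert S t t' lt) (trans (cong (nthᵇ S t' ∨_) (eqb-≢ t' t ne)) (∨-identityʳ _))
    go : ∀ u → WeakLe n (decode S) u → u ≡ decode S' → CoverAt n (decode S) (decode S')
    go u ε eq = ⊥-elim (true≢false (trans (cong (λ z → nthᵇ z t) eS) S't) nt)
      where
      eS : S ≡ S'
      eS = trans (sym (code-decode S)) (trans (cong code eq) (code-decode S'))
    go u (_◅_ {j = y} c st) eq = res (nthᵇ (code y) t) refl
      where
      st' : WeakLe n y (decode S')
      st' = subst (Star (Cover n) y) eq st
      iy : InInterval n v w y
      iy = proj₁ (decode-inInterval S) ◅◅ (c ◅ ε) , st' ◅◅ proj₂ (decode-inInterval S')
      Sfy : ∀ t' → t' < k → nthᵇ S t' ≡ true → nthᵇ (code y) t' ≡ true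
      Sfy = ⊆⇒nthᵇ S (code y) (subst (_⊆ code y) (code-decode S) (weakLe⇒code-⊆ (decode S) y (decode-inInterval S) iy (c ◅ ε)))
      fyS' : ∀ t' → t' < k → nthᵇ (code y) t' ≡ true → nthᵇ S' t' ≡ true
      fyS' = ⊆⇒nthᵇ (code y) S' (subst (code y ⊆_) (code-decode S') (weakLe⇒code-⊆ y (decode S') iy (decode-inInterval S') st'))
      res : ∀ b → nthᵇ (code y) t ≡ b → CoverAt n (decode S) (decode S')
      res true e = subst (CoverAt n (decode S)) ey (Cover⇒CoverAt n _ _ c)
        where
        fy : code y ≡ S'
        fy = nthᵇ-ext _ _ λ t' lt → h t' lt (t' ≟ t)
          where
          h : ∀ t' → t' < k → Dec (t' ≡ t) → nthᵇ (code y) t' ≡ nthᵇ S' t'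
          h t' lt (yes refl) = trans e (sym S't)
          h t' lt (no ne) = ⇔⇒≡ (fyS' t' lt) (λ x → Sfy t' lt (trans (sym (S'o t' lt ne)) x))
        ey : y ≡ decode S'
        ey = trans (sym (decode-code y iy)) (cong decode fy)
      res false e = ⊥-elim (cover-irreflexive {n} {decode S} (subst (CoverAt n (decode S)) ey (Cover⇒CoverAt n _ _ c)))
        where
        fy : code y ≡ S
        fy = nthᵇ-ext _ _ λ t' lt → h t' lt (t' ≟ t)
          where
          h : ∀ t' → t' < k → Dec (t' ≡ t) → nthᵇ (code y) t' ≡ nthᵇ S t'
          h t' lt (yes refl) = trans e (sym nt)
          h t' lt (no ne) = ⇔⇒≡ (λ x → trans (sym (S'o t' lt ne)) (fyS' t' lt x)) (Sfy t' lt)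
        ey : y ≡ decode S
        ey = trans (sym (decode-code y iy)) (cong decode fy)

  singleton : ℕ → Subset k
  singleton t = insert ∅S t

  nthᵇ-∅ : ∀ t → t < k → nthᵇ ∅S t ≡ false
  nthᵇ-∅ t lt = nthᵇ-tabulateN k _ t lt

  atom-cover : ∀ t → t < k → CoverAt n v (decode (singleton t))
  atom-cover t lt = subst (λ z → CoverAt n z (decode (singleton t))) decode-∅ (decode-insert-cover ∅S t lt (nthᵇ-∅ t lt))

  atomPos : ℕ → ℕ
  atomPos t with t <? k
  ... | yes lt = proj₁ (atom-cover t lt)
  ... | no _ = 0

  AtomAt : ℕ → Set
  AtomAt t = suc (atomPos t) < n × nth v (atomPos t) < nth v (suc (atomPos t)) × (∀ p → nth (decode (singleton t)) p ≡ nth v (adjSwap (atomPos t) p))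

  atomAt : ∀ t → t < k → AtomAt t
  atomAt t lt with t <? k
  ... | yes lt' = proj₂ (atom-cover t lt')
  ... | no nl = ⊥-elim (nl lt)

  nthᵇ-singleton : ∀ t t' → t' < k → nthᵇ (singleton t) t' ≡ eqb t' t
  nthᵇ-singleton t t' lt = trans (nthᵇ-insert ∅S t t' lt) (cong (_∨ eqb t' t) (nthᵇ-∅ t' lt))

  atomPos-injective : InjectiveBelow k atomPos
  atomPos-injective t t' lt lt' e = eqb⇒≡ t t' (trans (sym (nthᵇ-singleton t' t lt)) (trans (cong (λ z → nthᵇ z t) eS) (trans (nthᵇ-singleton t t lt) (eqb-refl t))))
    where
    eg : decode (singleton t') ≡ decode (singleton t)
    eg = nth-ext _ _ (λ p _ → trans (proj₂ (proj₂ (atomAt t' lt')) p) (trans (cong (λ z → nth v (adjSwap z p)) (sym e))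
                     (sym (proj₂ (proj₂ (atomAt t lt)) p))))
    eS : singleton t' ≡ singleton t
    eS = trans (sym (code-decode (singleton t'))) (trans (cong code eg) (code-decode (singleton t)))

  interval-injective : ∀ u → InInterval n v w u → InjectiveBelow n (nth u)
  interval-injective u iu = weakLe-injective (proj₁ iu) v-injective

  adjSwap-position : ∀ a (τ : Vec ℕ n) → suc a < n → (∀ p → nth τ p ≡ nth v (adjSwap a p)) → ∀ p m → p < n → m < n → nth τ p ≡ nth v m → p ≡ adjSwap a m
  adjSwap-position a τ sa h p m pn mn e = trans (sym (adjSwap-involutive a p)) (cong (adjSwap a) (v-injective _ _ (adjSwap-< n a p sa pn) mn (trans (sym (h p)) e)))

  atom-inversion : ∀ t → t < k → Inversion n (decode (singleton t)) (nth v (atomPos t)) (nth v (suc (atomPos t)))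
  atom-inversion t lt = inc , atomPos t , suc (atomPos t) , n<1+n _ , sa ,
                  trans (h (atomPos t)) (cong (nth v) (adjSwap-left _)) , trans (h (suc (atomPos t))) (cong (nth v) (adjSwap-right _))
    where
    sa = proj₁ (atomAt t lt)
    inc = proj₁ (proj₂ (atomAt t lt))
    h = proj₂ (proj₂ (atomAt t lt))

  atoms-nonadjacent : ∀ t t' → t < k → t' < k → atomPos t' ≢ suc (atomPos t)
  atoms-nonadjacent t t' lt lt' e = 1+n≢n (v-injective _ _ sa an (trans (sym (proj₁ n1)) (proj₁ n2)))
    where
    a = atomPos t
    sa : suc a < n
    sa = proj₁ (atomAt t lt)
    an : a < n
    an = ≤-trans (n≤1+n _) sa
    sa2 : suc (suc a) < n
    sa2 = subst (λ z → suc z < n) e (proj₁ (atomAt t' lt'))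
    tt' : t ≢ t'
    tt' refl = 1+n≢n (sym e)
    S2 = insert (singleton t) t'
    nt' : nthᵇ (singleton t) t' ≡ false
    nt' = trans (nthᵇ-singleton t t' lt') (eqb-≢ t' t (λ x → tt' (sym x)))
    c2 : CoverAt n (decode (singleton t)) (decode S2)
    c2 = decode-insert-cover (singleton t) t' lt' nt'
    below₁ : WeakLe n (decode (singleton t)) (decode S2)
    below₁ = decode-mono _ _ (λ x xl hx → trans (nthᵇ-insert (singleton t) t' x xl) (subst (λ z → z ∨ eqb x t' ≡ true) (sym hx) refl))
    below₂ : WeakLe n (decode (singleton t')) (decode S2)
    below₂ = decode-mono _ _ (λ x xl hx → trans (nthᵇ-insert (singleton t) t' x xl)
            (subst (λ z → nthᵇ (singleton t) x ∨ z ≡ true) (sym (trans (sym (nthᵇ-singleton t' x xl)) hx)) (∨-zeroʳ _)))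
    injT = interval-injective (decode S2) (decode-inInterval S2)
    i1 : Inversion n (decode S2) (nth v a) (nth v (suc a))
    i1 = inversion-weakLe below₁ (atom-inversion t lt)
    i2 : Inversion n (decode S2) (nth v (suc a)) (nth v (suc (suc a)))
    i2 = subst (λ z → Inversion n (decode S2) (nth v z) (nth v (suc z))) e (inversion-weakLe below₂ (atom-inversion t' lt'))
    i3 : Inversion n (decode S2) (nth v a) (nth v (suc (suc a)))
    i3 = inversion-trans {n} {decode S2} injT i1 i2
    h = proj₂ (proj₂ (atomAt t lt))
    ssa≢a : suc (suc a) ≢ a
    ssa≢a x = <-irrefl (sym x) (≤-trans (n<1+n a) (n≤1+n _))
    p2 : ∀ p → p < n → nth (decode (singleton t)) p ≡ nth v (suc (suc a)) → p ≡ suc (suc a)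
    p2 p pn ey = trans (adjSwap-position a (decode (singleton t)) sa h p (suc (suc a)) pn sa2 ey) (adjSwap-other a _ ssa≢a (1+n≢n))
    ni2 : ¬ Inversion n (decode (singleton t)) (nth v (suc a)) (nth v (suc (suc a)))
    ni2 (_ , p , q , pq , qn , ey , ex) = <-irrefl refl (<-trans (subst₂ _<_ (p2 p (<-trans pq qn) ey) q≡ pq) (≤-trans (n<1+n a) (n≤1+n _)))
      where
      q≡ : q ≡ a
      q≡ = trans (adjSwap-position a (decode (singleton t)) sa h q (suc a) qn sa ex) (adjSwap-right a)
    ni3 : ¬ Inversion n (decode (singleton t)) (nth v a) (nth v (suc (suc a)))
    ni3 (_ , p , q , pq , qn , ey , ex) = <-irrefl refl (<-trans (subst₂ _<_ (p2 p (<-trans pq qn) ey) q≡ pq) (n<1+n (suc a)))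
      where
      q≡ : q ≡ suc a
      q≡ = trans (adjSwap-position a (decode (singleton t)) sa h q a qn an ex) (adjSwap-left a)
    n1 = new-inversion {n} {decode (singleton t)} {decode S2} c2 i2 ni2
    n2 = new-inversion {n} {decode (singleton t)} {decode S2} c2 i3 ni3

  atomMarks : Marks
  atomMarks p = anyBelow k (λ t → eqb (atomPos t) p)

  atomMarks⇒atom : ∀ p → atomMarks p ≡ true → Σ ℕ λ t → t < k × atomPos t ≡ p
  atomMarks⇒atom p h with anyBelow⇒∃ k _ h
  ... | t , lt , x = t , lt , eqb⇒≡ _ _ x

  atom⇒atomMarks : ∀ t → t < k → atomMarks (atomPos t) ≡ true
  atom⇒atomMarks t lt = ∃⇒anyBelow k _ t lt (eqb-refl (atomPos t))

  atomMarks-admissible : Admissible n v atomMarks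
  atomMarks-admissible = v-permAt , kn , kadj , kinc
    where
    kn : ∀ p → atomMarks p ≡ true → suc p < n
    kn p h with atomMarks⇒atom p h
    ... | t , lt , refl = proj₁ (atomAt t lt)
    kadj : ∀ p → atomMarks p ≡ true → atomMarks (suc p) ≡ false
    kadj p h with atomMarks⇒atom p h | atomMarks (suc p) in e
    ... | _ | false = refl
    ... | t , lt , refl | true with atomMarks⇒atom _ e
    ...   | t' , lt' , e' = ⊥-elim (atoms-nonadjacent t t' lt lt' e')
    kinc : ∀ p → atomMarks p ≡ true → nth v p < nth v (suc p)
    kinc p h with atomMarks⇒atom p h
    ... | t , lt , refl = proj₁ (proj₂ (atomAt t lt))

  open AdmissibleSwaps {n} {v} {atomMarks} atomMarks-admissible hiding (v-injective)

  atomMarksOf : Subset k → Marks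
  atomMarksOf S p = anyBelow k (λ t → nthᵇ S t ∧ eqb (atomPos t) p)

  atomMarksOf-⊆ₘ : ∀ S → atomMarksOf S ⊆ₘ atomMarks
  atomMarksOf-⊆ₘ S p h with anyBelow⇒∃ k _ h
  ... | t , lt , x = ∃⇒anyBelow k _ t lt (proj₂ (∧-true⁻ {nthᵇ S t} x))

  anyBelow-cong : ∀ m h h' → (∀ t → t < m → h t ≡ h' t) → anyBelow m h ≡ anyBelow m h'
  anyBelow-cong zero h h' e = refl
  anyBelow-cong (suc m) h h' e = cong₂ _∨_ (anyBelow-cong m h h' (λ t lt → e t (m≤n⇒m≤1+n lt))) (e m ≤-refl)

  prefixBelow : Subset k → ℕ → Subset k
  prefixBelow S j = tabulateN k (λ t → nthᵇ S t ∧ ltb t j)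

  nthᵇ-prefixBelow : ∀ S j t → t < k → nthᵇ (prefixBelow S j) t ≡ nthᵇ S t ∧ ltb t j
  nthᵇ-prefixBelow S j t lt = nthᵇ-tabulateN k _ t lt

  prefixBelow-zero : ∀ S → prefixBelow S 0 ≡ ∅S
  prefixBelow-zero S = nthᵇ-ext _ _ (λ t lt → trans (nthᵇ-prefixBelow S 0 t lt) (trans (∧-zeroʳ _) (sym (nthᵇ-∅ t lt))))

  prefixBelow-all : ∀ S → prefixBelow S k ≡ S
  prefixBelow-all S = nthᵇ-ext _ _ (λ t lt → trans (nthᵇ-prefixBelow S k t lt) (trans (cong (nthᵇ S t ∧_) (<⇒ltb t k lt)) (∧-identityʳ _)))

  atomMarksOf-∅ : ∀ p → atomMarksOf ∅S p ≡ noMarks p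
  atomMarksOf-∅ p with atomMarksOf ∅S p in e
  ... | false = refl
  ... | true with anyBelow⇒∃ k _ e
  ...   | t , lt , x = ⊥-elim (true≢false (proj₁ (∧-true⁻ {nthᵇ ∅S t} x)) (nthᵇ-∅ t lt))

  atomMarksOf-insert : ∀ A j → j < k → ∀ p → atomMarksOf (insert A j) p ≡ mark (atomMarksOf A) (atomPos j) p
  atomMarksOf-insert A j lt p = ⇔⇒≡ to' fr
    where
    to' : atomMarksOf (insert A j) p ≡ true → mark (atomMarksOf A) (atomPos j) p ≡ true
    to' h with anyBelow⇒∃ k _ h
    ... | t , tl , x with ∧-true⁻ {nthᵇ (insert A j) t} x
    ...   | x1 , x2 with nthᵇ A t in eA
    ...     | true = subst (λ z → z ∨ eqb p (atomPos j) ≡ true) (sym (∃⇒anyBelow k _ t tl (subst (λ z → z ∧ eqb (atomPos t) p ≡ true) (sym eA) x2))) refl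
    ...     | false = trans (cong (atomMarksOf A p ∨_) (subst (λ z → eqb p z ≡ true) (cong atomPos tj) (subst (λ z → eqb z (atomPos t) ≡ true) (eqb⇒≡ (atomPos t) p x2) (eqb-refl (atomPos t))))) (∨-zeroʳ _)
      where
      tj : t ≡ j
      tj = eqb⇒≡ t j (trans (sym (trans (nthᵇ-insert A j t tl) (cong (_∨ eqb t j) eA))) x1)
    fr : mark (atomMarksOf A) (atomPos j) p ≡ true → atomMarksOf (insert A j) p ≡ true
    fr h with atomMarksOf A p in e1
    ... | true with anyBelow⇒∃ k _ e1
    ...   | t , tl , x = ∃⇒anyBelow k _ t tl (subst (λ z → z ∧ eqb (atomPos t) p ≡ true)
              (sym (trans (nthᵇ-insert A j t tl) (subst (λ z → z ∨ eqb t j ≡ true) (sym (proj₁ (∧-true⁻ {nthᵇ A t} x))) refl)))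
              (proj₂ (∧-true⁻ {nthᵇ A t} x)))
    fr h | false = ∃⇒anyBelow k _ j lt (subst (λ z → z ∧ eqb (atomPos j) p ≡ true)
              (sym (trans (nthᵇ-insert A j j lt) (trans (cong (nthᵇ A j ∨_) (eqb-refl j)) (∨-zeroʳ _))))
              (subst (λ z → eqb (atomPos j) z ≡ true) (sym (eqb⇒≡ p (atomPos j) h)) (eqb-refl (atomPos j))))

  -- The cover decode A ⋖ decode (insert A j) creates the inversion (v a, v (a + 1)) with a = atomPos j,
  -- and in decode A those two values still sit at positions a, a + 1; so the cover swaps position a.
  decode-insert : ∀ A j → j < k → nthᵇ A j ≡ false → decode A ≡ applySwaps n v (atomMarksOf A) →
                  decode (insert A j) ≡ applySwaps n v (mark (atomMarksOf A) (atomPos j))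
  decode-insert A j lt nA decode-A = nth-ext _ _ (λ p _ → trans (proj₂ (proj₂ (proj₂ c)) p) (trans (cong (λ z → nth (decode A) (adjSwap z p)) m≡a)
       (trans (cong (λ z → nth z (adjSwap a p)) decode-A)
       (sym (proj₂ (proj₂ (proj₂ (cover-mark (atomMarksOf A) a (atomMarksOf-⊆ₘ A) ka a-unmarked))) p)))))
    where
    B = insert A j
    c = decode-insert-cover A j lt nA
    a = atomPos j
    ka = atom⇒atomMarks j lt
    sa : suc a < n
    sa = proj₁ (atomAt j lt)
    an : a < n
    an = ≤-trans (n≤1+n _) sa
    a-unmarked : atomMarksOf A a ≡ false
    a-unmarked with atomMarksOf A a in e2
    ... | false = refl
    ... | true with anyBelow⇒∃ k _ e2
    ...   | t , tl , x = ⊥-elim (true≢false (subst (λ z → nthᵇ A z ≡ true) (atomPos-injective t j tl lt (eqb⇒≡ _ _ (proj₂ (∧-true⁻ {nthᵇ A t} x))))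
                                        (proj₁ (∧-true⁻ {nthᵇ A t} x))) nA)
    suc-a-unmarked : atomMarksOf A (suc a) ≡ false
    suc-a-unmarked = ⊆ₘ-unmarked (atomMarksOf A) (atomMarksOf-⊆ₘ A) (suc a) (marked⇒next-unmarked a ka)
    before-a-unmarked : ∀ p' → a ≡ suc p' → atomMarksOf A p' ≡ false
    before-a-unmarked p' eq = ⊆ₘ-unmarked (atomMarksOf A) (atomMarksOf-⊆ₘ A) p' (marked⇒prev-unmarked {n} {v} {atomMarks} atomMarks-admissible a p' ka eq)
    nth-decode-A : ∀ p → p < n → nth (decode A) p ≡ nth v (partner (atomMarksOf A) p)
    nth-decode-A p pn = trans (cong (λ z → nth z p) decode-A) (nth-applySwaps n v (atomMarksOf A) p pn)
    position-in-A : ∀ p m → p < n → m < n → nth (decode A) p ≡ nth v m → p ≡ partner (atomMarksOf A) m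
    position-in-A p m pn mn eq = trans (sym (partner-involutive {n} {v} {atomMarks} atomMarks-admissible (atomMarksOf A) (atomMarksOf-⊆ₘ A) p))
                          (cong (partner (atomMarksOf A)) (v-injective _ _ (partner-< {n} {v} {atomMarks} atomMarks-admissible (atomMarksOf A) (atomMarksOf-⊆ₘ A) p pn) mn (trans (sym (nth-decode-A p pn)) eq)))
    partner-a : partner (atomMarksOf A) a ≡ a
    partner-a = partner-unmarked (atomMarksOf A) a a-unmarked before-a-unmarked
    partner-suc-a : partner (atomMarksOf A) (suc a) ≡ suc a
    partner-suc-a = partner-unmarked (atomMarksOf A) (suc a) suc-a-unmarked (λ { _ refl → a-unmarked })
    inversion-in-B : Inversion n (decode B) (nth v a) (nth v (suc a))
    inversion-in-B = inversion-weakLe (decode-mono (singleton j) B (λ t tl ht → trans (nthᵇ-insert A j t tl)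
             (subst (λ z → nthᵇ A t ∨ z ≡ true) (sym (trans (sym (nthᵇ-singleton j t tl)) ht)) (∨-zeroʳ _)))) (atom-inversion j lt)
    no-inversion-in-A : ¬ Inversion n (decode A) (nth v a) (nth v (suc a))
    no-inversion-in-A (_ , p , q , pq , qn , ey , ex) = <-asym pq (subst₂ _<_ (sym q≡) (sym p≡) (n<1+n a))
      where
      p≡ : p ≡ suc a
      p≡ = trans (position-in-A p (suc a) (<-trans pq qn) sa ey) partner-suc-a
      q≡ : q ≡ a
      q≡ = trans (position-in-A q a qn an ex) partner-a
    m = proj₁ c
    created = new-inversion {n} {decode A} {decode B} c inversion-in-B no-inversion-in-A
    m≡a : m ≡ a
    m≡a = trans (position-in-A m a (≤-trans (n≤1+n _) (proj₁ (proj₂ c))) an (proj₁ created)) partner-a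

  decode-prefix≡applySwaps : ∀ S j → decode (prefixBelow S j) ≡ applySwaps n v (atomMarksOf (prefixBelow S j))
  decode-prefix≡applySwaps S zero = trans (cong decode (prefixBelow-zero S)) (trans decode-∅ (trans (applySwaps-noMarks n v)
                    (applySwaps-cong n v _ _ (λ p → sym (trans (cong (λ z → atomMarksOf z p) (prefixBelow-zero S)) (atomMarksOf-∅ p))))))
  decode-prefix≡applySwaps S (suc j) = go (j <? k) (nthᵇ S j) refl
    where
    A = prefixBelow S j
    A' = prefixBelow S (suc j)
    IH = decode-prefix≡applySwaps S j
    same : (¬ j < k ⊎ nthᵇ S j ≡ false) → A' ≡ A
    same c = nthᵇ-ext _ _ (λ t lt → trans (nthᵇ-prefixBelow S (suc j) t lt) (trans (h t lt (t ≟ j)) (sym (nthᵇ-prefixBelow S j t lt))))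
      where
      h : ∀ t → t < k → Dec (t ≡ j) → nthᵇ S t ∧ ltb t (suc j) ≡ nthᵇ S t ∧ ltb t j
      h t lt (yes refl) = hc c
        where
        hc : (¬ t < k ⊎ nthᵇ S t ≡ false) → nthᵇ S t ∧ ltb t (suc t) ≡ nthᵇ S t ∧ ltb t t
        hc (inj₁ nl) = ⊥-elim (nl lt)
        hc (inj₂ e) = trans (cong (_∧ ltb t (suc t)) e) (sym (cong (_∧ ltb t t) e))
      h t lt (no ne) rewrite ltb-suc t j | eqb-≢ t j ne | ∨-identityʳ (ltb t j) = refl
    go : Dec (j < k) → ∀ b → nthᵇ S j ≡ b → decode A' ≡ applySwaps n v (atomMarksOf A')
    go (no nl) _ _ rewrite same (inj₁ nl) = IH
    go (yes lt) false e rewrite same (inj₂ e) = IH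
    go (yes lt) true e = trans (cong decode eA') (trans (decode-insert A j lt nA IH) (applySwaps-cong n v _ _ (λ p → trans (sym (atomMarksOf-insert A j lt p)) (cong (λ z → atomMarksOf z p) (sym eA')))))
      where
      B = insert A j
      eA' : A' ≡ B
      eA' = nthᵇ-ext _ _ (λ t lt' → trans (nthᵇ-prefixBelow S (suc j) t lt') (trans (h t lt' (t ≟ j)) (sym (nthᵇ-insert A j t lt'))))
        where
        h : ∀ t → t < k → Dec (t ≡ j) → nthᵇ S t ∧ ltb t (suc j) ≡ nthᵇ A t ∨ eqb t j
        h t lt' (yes refl) rewrite nthᵇ-prefixBelow S t t lt' | e | ltb-suc t t | ltb-refl t | eqb-refl t = refl
        h t lt' (no ne) rewrite nthᵇ-prefixBelow S j t lt' | ltb-suc t j | eqb-≢ t j ne | ∨-identityʳ (ltb t j) | ∨-identityʳ (nthᵇ S t ∧ ltb t j) = refl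
      nA : nthᵇ A j ≡ false
      nA = trans (nthᵇ-prefixBelow S j j lt) (trans (cong (nthᵇ S j ∧_) (ltb-refl j)) (∧-zeroʳ _))
  decode≡applySwaps : ∀ S → decode S ≡ applySwaps n v (atomMarksOf S)
  decode≡applySwaps S = trans (cong decode (sym (prefixBelow-all S))) (trans (decode-prefix≡applySwaps S k) (cong (λ z → applySwaps n v (atomMarksOf z)) (prefixBelow-all S)))

  w≡applySwaps : w ≡ applySwaps n v atomMarks
  w≡applySwaps = trans (sym decode-⊤) (trans (decode≡applySwaps ⊤S) (applySwaps-cong n v _ _ (λ p → anyBelow-cong k _ _
         (λ t lt → cong (_∧ eqb (atomPos t) p) (nthᵇ-tabulateN k _ t lt)))))

  swapsBetween≡atomMarks : ∀ p → swapsBetween n v w p ≡ atomMarks p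
  swapsBetween≡atomMarks p = trans (cong (λ z → swapsBetween n v z p) w≡applySwaps) (swapsBetween-applySwaps {n} {v} {atomMarks} atomMarks-admissible p)

  count-atomMarks : count n atomMarks ≡ k
  count-atomMarks = count-anyBelow k ≤-refl
    where
    indicator-∨ : ∀ a b → (a ≡ true → b ≡ true → ⊥) → indicator (a ∨ b) ≡ indicator a + indicator b
    indicator-∨ true true d = ⊥-elim (d refl refl)
    indicator-∨ true false d = refl
    indicator-∨ false b d = refl
    count-anyBelow : ∀ m → m ≤ k → count n (λ p → anyBelow m (λ t → eqb (atomPos t) p)) ≡ m
    count-anyBelow zero _ = Σ-zero n _ (λ _ _ → refl)
    count-anyBelow (suc m) mk = trans (Σ-cong n _ _ (λ p _ → indicator-∨ _ _ (disjoint p)))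
                     (trans (Σ-+-distrib n _ _) (trans (cong₂ _+_ (count-anyBelow m (≤-trans (n≤1+n m) mk)) count-singleton) (+-comm m 1)))
      where
      r : ∀ t → t < suc m → atomPos t < n
      r t lt = ≤-trans (n≤1+n _) (proj₁ (atomAt t (≤-trans lt mk)))
      disjoint : ∀ p → anyBelow m (λ t → eqb (atomPos t) p) ≡ true → eqb (atomPos m) p ≡ true → ⊥
      disjoint p h1 h2 with anyBelow⇒∃ m _ h1
      ... | t , tl , x = <-irrefl (atomPos-injective t m (≤-trans (m≤n⇒m≤1+n tl) mk) mk (trans (eqb⇒≡ _ _ x) (sym (eqb⇒≡ _ _ h2)))) tl
      count-singleton : count n (λ p → eqb (atomPos m) p) ≡ 1
      count-singleton = trans (Σ-single n _ (atomPos m) (r m ≤-refl) (λ p _ ne → cong indicator (eqb-≢ (atomPos m) p (λ e → ne (sym e)))))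
                  (cong indicator (eqb-refl (atomPos m)))

  swapsBetween-spec : Admissible n v (swapsBetween n v w) × count n (swapsBetween n v w) ≡ k × w ≡ applySwaps n v (swapsBetween n v w)
  swapsBetween-spec = valK , trans (Σ-cong n _ _ (λ p _ → cong indicator (swapsBetween≡atomMarks p))) count-atomMarks ,
           trans w≡applySwaps (applySwaps-cong n v _ _ (λ p → sym (swapsBetween≡atomMarks p)))
    where
    valK : Admissible n v (swapsBetween n v w)
    valK = v-permAt , (λ p h → marked⇒suc<n p (subst (_≡ true) (swapsBetween≡atomMarks p) h)) ,
           (λ p h → trans (swapsBetween≡atomMarks (suc p)) (marked⇒next-unmarked p (subst (_≡ true) (swapsBetween≡atomMarks p) h))) ,
           (λ p h → marked⇒ascent p (subst (_≡ true) (swapsBetween≡atomMarks p) h))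

-- The unit Fubini ranking of an admissible swap set

toList-tabulateN : ∀ {A : Set} n (h : ℕ → A) → toList (tabulateN n h) ≡ applyUpTo h n
toList-tabulateN zero h = refl
toList-tabulateN (suc n) h = cong (h 0 ∷_) (toList-tabulateN n (h ∘ suc))

length-filter : ∀ {n} (v : Vec ℕ n) {ℓ} {P : Pred ℕ ℓ} (P? : Decidable P) →
             length (filter P? (toList v)) ≡ count n (λ c → does (P? (nth v c)))
length-filter [] P? = refl
length-filter {suc n} (x ∷ v) P? with does (P? x) in e
... | true = trans (cong suc (length-filter v P?)) (sym (trans (Σ-shift n _) (cong (_+ count n (λ c → does (P? (nth v c)))) (cong indicator e))))
... | false = trans (length-filter v P?) (sym (trans (Σ-shift n _) (cong (_+ count n (λ c → does (P? (nth v c)))) (cong indicator e))))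

∈-toList⁻ : ∀ {n} (v : Vec ℕ n) x → x ∈ toList v → Σ ℕ λ p → p < n × nth v p ≡ x
∈-toList⁻ (y ∷ v) x (here refl) = 0 , s≤s z≤n , refl
∈-toList⁻ (y ∷ v) x (there m) with ∈-toList⁻ v x m
... | p , lt , e = suc p , s≤s lt , e

∈-toList⁺ : ∀ {n} (v : Vec ℕ n) p → p < n → nth v p ∈ toList v
∈-toList⁺ (y ∷ v) zero _ = here refl
∈-toList⁺ (y ∷ v) (suc p) (s≤s lt) = there (∈-toList⁺ v p lt)

memberᵇ : ℕ → List ℕ → Bool
memberᵇ a xs = does (Any.any? (a ≟_) xs)

memberᵇ⇒∈ : ∀ a xs → memberᵇ a xs ≡ true → a ∈ xs
memberᵇ⇒∈ a xs e with Any.any? (a ≟_) xs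
... | yes m = m
... | no _ = ⊥-elim (true≢false e refl)

∈⇒memberᵇ : ∀ a xs → a ∈ xs → memberᵇ a xs ≡ true
∈⇒memberᵇ a xs m with Any.any? (a ≟_) xs
... | yes _ = refl
... | no nm = ⊥-elim (nm m)

length-unique : ∀ B (xs : List ℕ) → Unique xs → All (_< B) xs → length xs ≡ count B (λ a → memberᵇ a xs)
length-unique B [] _ _ = sym (Σ-zero B _ (λ _ _ → refl))
length-unique B (x ∷ xs) (nx AllPairs.∷ u) (xB ∷ a) =
  trans (cong suc (length-unique B xs u a)) (sym (trans (Σ-cong B _ _ (λ p _ → split p))
    (trans (Σ-+-distrib B _ _) (trans (cong (_+ count B (λ a → memberᵇ a xs)) one) refl))))
  where
  split : ∀ p → indicator (memberᵇ p (x ∷ xs)) ≡ indicator (eqb p x) + indicator (memberᵇ p xs)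
  split p with p ≟ x
  ... | yes refl = trans (cong indicator (∈⇒memberᵇ x (x ∷ xs) (here refl)))
                    (sym (trans (cong₂ _+_ (cong indicator (eqb-refl x)) (cong indicator (mx (memberᵇ x xs) refl))) refl))
    where
    mx : ∀ b → memberᵇ x xs ≡ b → memberᵇ x xs ≡ false
    mx true e = ⊥-elim (All.lookup nx (memberᵇ⇒∈ x xs e) refl)
    mx false e = e
  ... | no ne = trans (cong indicator (⇔⇒≡ {memberᵇ p (x ∷ xs)} {memberᵇ p xs}
                  (λ e → ∈⇒memberᵇ p xs (th (memberᵇ⇒∈ p (x ∷ xs) e))) (λ e → ∈⇒memberᵇ p (x ∷ xs) (there (memberᵇ⇒∈ p xs e)))))
                  (cong (_+ indicator (memberᵇ p xs)) (cong indicator (sym (eqb-≢ p x ne))))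
    where
    th : p ∈ x ∷ xs → p ∈ xs
    th (here e) = ⊥-elim (ne e)
    th (there m) = m
  one : count B (λ p → eqb p x) ≡ 1
  one = trans (Σ-single B _ x xB (λ p _ ne → cong indicator (eqb-≢ p x ne))) (cong indicator (eqb-refl x))

suc-pred-≥1 : ∀ x → 1 ≤ x → suc (pred x) ≡ x
suc-pred-≥1 (suc x) _ = refl

position : ∀ {n} → Vec ℕ n → ℕ → ℕ
position [] x = 0
position (y ∷ ys) x = if eqb y x then 0 else suc (position ys x)

position-nth : ∀ {n} (v : Vec ℕ n) → InjectiveBelow n (nth v) → ∀ p → p < n → position v (nth v p) ≡ p
position-nth (y ∷ v) inj zero _ rewrite eqb-refl y = refl
position-nth (y ∷ v) inj (suc p) (s≤s lt) rewrite eqb-≢ y (nth v p) (λ e → 0≢1+n (inj 0 (suc p) (s≤s z≤n) (s≤s lt) e)) =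
  cong suc (position-nth v (λ a b la lb e → suc-injective (inj (suc a) (suc b) (s≤s la) (s≤s lb) e)) p lt)

does-<? : ∀ x a → does (x <? a) ≡ ltb x a
does-<? zero zero = refl
does-<? zero (suc a) = refl
does-<? (suc x) zero = refl
does-<? (suc x) (suc a) = does-<? x a

-- The competitor finishing at position p (0-based) gets rank p + 1, unless it follows a marked
-- position, in which case it ties with its left neighbour.
rank : Marks → ℕ → ℕ
rank K zero = 1
rank K (suc p) = if K p then suc p else suc (suc p)

rank-cong : ∀ K1 K2 → (∀ p → K1 p ≡ K2 p) → ∀ p → rank K1 p ≡ rank K2 p
rank-cong K1 K2 h zero = refl
rank-cong K1 K2 h (suc p) rewrite h p = refl

rank≤suc : ∀ K p → rank K p ≤ suc p
rank≤suc K zero = ≤-refl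
rank≤suc K (suc p) with K p
... | true = n≤1+n _
... | false = ≤-refl

≤rank : ∀ K p → p ≤ rank K p
≤rank K zero = z≤n
≤rank K (suc p) with K p
... | true = ≤-refl
... | false = n≤1+n _

rank≥1 : ∀ K p → 1 ≤ rank K p
rank≥1 K zero = ≤-refl
rank≥1 K (suc p) with K p
... | true = s≤s z≤n
... | false = s≤s z≤n

rank-unmarked : ∀ K p → (∀ p' → p ≡ suc p' → K p' ≡ false) → rank K p ≡ suc p
rank-unmarked K zero h = refl
rank-unmarked K (suc p) h rewrite h p refl = refl

rank-after-marked : ∀ K p → K p ≡ true → rank K (suc p) ≡ suc p
rank-after-marked K p e rewrite e = refl

rankView : ∀ K p → (rank K p ≡ suc p × (∀ p' → p ≡ suc p' → K p' ≡ false)) ⊎ (Σ ℕ λ p' → p ≡ suc p' × K p' ≡ true × rank K p ≡ p)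
rankView K zero = inj₁ (refl , λ _ ())
rankView K (suc p) with K p in e
... | true = inj₂ (p , refl , e , refl)
... | false = inj₁ (refl , λ { _ refl → e })

rank-mono : ∀ K p p' → p ≤ p' → rank K p ≤ rank K p'
rank-mono K p p' le with m≤n⇒m<n∨m≡n le
... | inj₂ refl = ≤-refl
... | inj₁ lt = ≤-trans (rank≤suc K p) (≤-trans lt (≤rank K p'))

rank-fibre : ∀ K x y → rank K x ≡ rank K y → x ≡ y ⊎ (K x ≡ true × y ≡ suc x) ⊎ (K y ≡ true × x ≡ suc y)
rank-fibre K x y e with rankView K x | rankView K y
... | inj₁ (ex , _) | inj₁ (ey , _) = inj₁ (suc-injective (trans (sym ex) (trans e ey)))
... | inj₁ (ex , _) | inj₂ (y' , refl , ky , ey) = inj₂ (inj₁ (subst (λ z → K z ≡ true) (sym xy) ky , cong suc (sym xy)))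
  where
  xy : x ≡ y'
  xy = suc-injective (trans (sym ex) (trans e ey))
... | inj₂ (x' , refl , kx , ex) | inj₁ (ey , _) = inj₂ (inj₂ (subst (λ z → K z ≡ true) (sym yx) kx , cong suc (sym yx)))
  where
  yx : y ≡ x'
  yx = suc-injective (trans (sym ey) (trans (sym e) ex))
... | inj₂ (x' , refl , kx , ex) | inj₂ (y' , refl , ky , ey) = inj₁ (trans (sym ex) (trans e ey))

count-ltb-all : ∀ n m → n ≤ m → count n (λ p → ltb p m) ≡ n
count-ltb-all zero m _ = refl
count-ltb-all (suc n) m le = trans (cong₂ _+_ (count-ltb-all n m (≤-trans (n≤1+n n) le)) (cong indicator (<⇒ltb n m le))) (+-comm n 1)

count-ltb : ∀ n m → m ≤ n → count n (λ p → ltb p m) ≡ m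
count-ltb zero zero _ = refl
count-ltb (suc n) m le with m ≟ suc n
... | yes refl = count-ltb-all (suc n) (suc n) ≤-refl
... | no ne = trans (cong₂ _+_ (count-ltb n m (≤-pred (≤∧≢⇒< le ne))) (cong indicator (≮⇒ltb n m (λ x → <-irrefl refl (<-≤-trans x (≤-pred (≤∧≢⇒< le ne))))))) (+-identityʳ m)

module Inverse {n : ℕ} {v : Vec ℕ n} (pv : PermAt n v) where
  v-injective : InjectiveBelow n (nth v)
  v-injective = proj₂ pv
  v-range : ∀ p → p < n → 1 ≤ nth v p × nth v p ≤ n
  v-range = proj₁ pv

  prev : ℕ → ℕ
  prev p = pred (nth v p)

  prev-injective : InjectiveBelow n prev
  prev-injective a b la lb e = v-injective a b la lb (trans (sym (suc-pred-≥1 (nth v a) la')) (trans (cong suc e) (suc-pred-≥1 (nth v b) lb')))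
    where
    la' = proj₁ (v-range a la)
    lb' = proj₁ (v-range b lb)

  prev-< : ∀ p → p < n → prev p < n
  prev-< p lt with nth v p | v-range p lt
  ... | suc x | _ , le = le

  inverse : ℕ → ℕ
  inverse c = position v (suc c)

  inverse-spec : ∀ c → c < n → inverse c < n × nth v (inverse c) ≡ suc c
  inverse-spec c lt with injective⇒surjective n prev prev-injective prev-< c lt
  ... | p , pn , e = subst (_< n) (sym qp) pn , trans (cong (nth v) qp) lvp
    where
    lvp : nth v p ≡ suc c
    lvp = trans (sym (suc-pred-≥1 (nth v p) (proj₁ (v-range p pn)))) (cong suc e)
    qp : inverse c ≡ p
    qp = trans (cong (position v) (sym lvp)) (position-nth v v-injective p pn)

  inverse-injective : InjectiveBelow n inverse
  inverse-injective a b la lb e = suc-injective (trans (sym (proj₂ (inverse-spec a la))) (trans (cong (nth v) e) (proj₂ (inverse-spec b lb))))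

  inverse-< : ∀ c → c < n → inverse c < n
  inverse-< c lt = proj₁ (inverse-spec c lt)

  inverse-prev : ∀ p → p < n → inverse (prev p) ≡ p
  inverse-prev p lt = trans (cong (position v) (suc-pred-≥1 (nth v p) (proj₁ (v-range p lt)))) (position-nth v v-injective p lt)

  prev-inverse : ∀ c → c < n → prev (inverse c) ≡ c
  prev-inverse c lt = cong pred (proj₂ (inverse-spec c lt))

-- v lists the competitors (numbered 1, …, n) in finishing order, so competitor c (0-based) finishes
-- at position v⁻¹(c + 1).
toFubini : (n : ℕ) → Vec ℕ n → Marks → Vec ℕ n
toFubini n v K = tabulateN n (λ c → rank K (position v (suc c)))

toFubini-cong : ∀ n v K1 K2 → (∀ p → K1 p ≡ K2 p) → toFubini n v K1 ≡ toFubini n v K2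
toFubini-cong n v K1 K2 h = nth-ext _ _ (λ c cn → trans (nth-tabulateN n _ c cn)
  (trans (rank-cong K1 K2 h (position v (suc c))) (sym (nth-tabulateN n _ c cn))))

module FubiniOf {n : ℕ} {v : Vec ℕ n} {K : Marks} (val : Admissible n v K) where
  open Inverse {n} {v} (proj₁ val) public
  marked⇒suc<n : ∀ p → K p ≡ true → suc p < n
  marked⇒suc<n = proj₁ (proj₂ val)
  marked⇒next-unmarked : ∀ p → K p ≡ true → K (suc p) ≡ false
  marked⇒next-unmarked = proj₁ (proj₂ (proj₂ val))
  marked⇒ascent : ∀ p → K p ≡ true → nth v p < nth v (suc p)
  marked⇒ascent = proj₂ (proj₂ (proj₂ val))

  r : Vec ℕ n
  r = toFubini n v K

  nth-ranking : ∀ c → c < n → nth r c ≡ rank K (inverse c)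
  nth-ranking c lt = nth-tabulateN n _ c lt

  count-lower-ranks : ∀ p0 → p0 < n → count n (λ p → ltb (rank K p) (rank K p0)) ≡ pred (rank K p0)
  count-lower-ranks p0 p0n = trans (Σ-cong n _ _ (λ p pn → cong indicator (pw p pn))) (count-ltb n _ (≤-trans m≤p0 (<⇒≤ p0n)))
    where
    R = rank K p0
    m≤p0 : pred R ≤ p0
    m≤p0 = ≤-pred (subst (_≤ suc p0) (sym (suc-pred-≥1 R (rank≥1 K p0))) (rank≤suc K p0))
    pw : ∀ p → p < n → ltb (rank K p) R ≡ ltb p (pred R)
    pw p pn = ⇔⇒≡ to' fr
      where
      to' : ltb (rank K p) R ≡ true → ltb p (pred R) ≡ true
      to' h with p <? pred R
      ... | yes lt = <⇒ltb _ _ lt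
      ... | no nl = ⊥-elim (c1 (ltb⇒< _ _ h))
        where
        c1 : rank K p < R → ⊥
        c1 lt with p0 ≤? p
        ... | yes le = <-irrefl refl (<-≤-trans lt (rank-mono K p0 p le))
        ... | no pl0 with rankView K p0
        ...   | inj₁ (e , _) = nl (subst (p <_) (cong pred (sym e)) (≰⇒> pl0))
        ...   | inj₂ (p' , refl , kp' , e) = <-irrefl refl (<-≤-trans lt (≤-reflexive (trans e (sym rkp))))
          where
          pp' : p ≡ p'
          pp' = ≤-antisym (≤-pred (≰⇒> pl0)) (≮⇒≥ (λ x → nl (subst (p <_) (cong pred (sym e)) x)))
          rkp : rank K p ≡ suc p'
          rkp = trans (cong (rank K) pp') (rank-unmarked K p' (λ p'' e' → notprev p'' e'))
            where
            notprev : ∀ p'' → p' ≡ suc p'' → K p'' ≡ false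
            notprev p'' e' = marked⇒prev-unmarked {n} {v} {K} val p' p'' kp' e'
      fr : ltb p (pred R) ≡ true → ltb (rank K p) R ≡ true
      fr h = <⇒ltb _ _ (≤-trans (s≤s (rank≤suc K p)) (≤-trans (s≤s (ltb⇒< _ _ h)) (≤-reflexive (suc-pred-≥1 R (rank≥1 K p0)))))

  isFubini : IsFubiniRanking n r
  isFubini = inRange , fub
    where
    inRange : InRange n r
    inRange = nth⇒All r (λ c lt → subst (λ z → 1 ≤ z × z ≤ n) (sym (nth-ranking c lt))
            (rank≥1 K (inverse c) , ≤-trans (rank≤suc K (inverse c)) (inverse-< c lt)))
    fub : (i : Fin n) → lookup r i ≡ suc (length (filter (λ x → x <? lookup r i) (toList r)))
    fub i = trans (lookup≡nth r i) (trans (sym (suc-pred-≥1 (nth r c) (subst (1 ≤_) (sym (nth-ranking c cn)) (rank≥1 K (inverse c))))) (cong suc (sym chain)))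
      where
      c = toℕ i
      cn = Finₚ.toℕ<n i
      R = rank K (inverse c)
      chain : length (filter (λ x → x <? lookup r i) (toList r)) ≡ pred (nth r c)
      chain = begin
        length (filter (λ x → x <? lookup r i) (toList r))
          ≡⟨ length-filter r (λ x → x <? lookup r i) ⟩
        count n (λ c' → does (nth r c' <? lookup r i))
          ≡⟨ Σ-cong n _ _ (λ c' lt → cong indicator (trans (does-<? (nth r c') (lookup r i)) (cong₂ ltb (nth-ranking c' lt) (trans (lookup≡nth r i) (nth-ranking c cn))))) ⟩
        Σ< n ((λ p → indicator (ltb (rank K p) R)) ∘ inverse)
          ≡⟨ Σ-reindex n inverse _ inverse-injective inverse-< ⟩
        count n (λ p → ltb (rank K p) R)
          ≡⟨ count-lower-ranks (inverse c) (inverse-< c cn) ⟩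
        pred R
          ≡⟨ cong pred (sym (nth-ranking c cn)) ⟩
        pred (nth r c) ∎
        where open ≡-Reasoning

head-filter-applyUpTo : ∀ {ℓ} {P : Pred ℕ ℓ} (P? : Decidable P) m f i0 → i0 < m → P (f i0) → (∀ i → i < i0 → ¬ P (f i)) →
             head (filter P? (applyUpTo f m)) ≡ just (f i0)
head-filter-applyUpTo P? (suc m) f zero _ p0 _ rewrite filter-accept P? {f 0} {applyUpTo (f ∘ suc) m} p0 = refl
head-filter-applyUpTo P? (suc m) f (suc i0) (s≤s lt) p0 h rewrite filter-reject P? {f 0} {applyUpTo (f ∘ suc) m} (h 0 (s≤s z≤n)) =
  head-filter-applyUpTo P? m (f ∘ suc) i0 lt p0 (λ i l → h (suc i) (s≤s l))

firstFree-spec : ∀ N occ a s0 → 1 ≤ s0 → s0 ≤ N → a ≤ s0 → s0 ∉ occ →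
                 (∀ s → a ≤ s → s < s0 → s ∈ occ) → firstFree N occ a ≡ just s0
firstFree-spec N occ a (suc s') _ sN as0 nin h =
  trans (cong (λ l → head (filter P? l)) (map-applyUpTo id suc N))
        (head-filter-applyUpTo P? N suc s' sN (as0 , nin) (λ i lt (ai , ni) → ni (h (suc i) ai (s≤s lt))))
  where
  P? = λ s → (a ≤? s) ×-dec ¬? (s ∈? occ)

segment : ∀ {X : Set} → (ℕ → X) → ℕ → ℕ → List X
segment f c zero = []
segment f c (suc m) = f c ∷ segment f (suc c) m

applyUpTo-cong : ∀ {X : Set} (f g : ℕ → X) m → (∀ i → f i ≡ g i) → applyUpTo f m ≡ applyUpTo g m
applyUpTo-cong f g zero h = refl
applyUpTo-cong f g (suc m) h = cong₂ _∷_ (h 0) (applyUpTo-cong (f ∘ suc) (g ∘ suc) m (h ∘ suc))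

applyUpTo-segment : ∀ {X : Set} (f : ℕ → X) c m → applyUpTo (λ i → f (c + i)) m ≡ segment f c m
applyUpTo-segment f c zero = refl
applyUpTo-segment f c (suc m) = cong₂ _∷_ (cong f (+-identityʳ c))
  (trans (applyUpTo-cong _ _ m (λ i → cong f (+-suc c i))) (applyUpTo-segment f (suc c) m))

All-segment : ∀ {X : Set} {P : X → Set} (f : ℕ → X) c m → (∀ i → P (f i)) → All P (segment f c m)
All-segment f c zero h = []
All-segment f c (suc m) h = h c ∷ All-segment f (suc c) m h

zip-segment : ∀ {X Y : Set} (f : ℕ → X) (g : ℕ → Y) c m → zip (segment f c m) (segment g c m) ≡ segment (λ i → (f i , g i)) c m
zip-segment f g c zero = refl
zip-segment f g c (suc m) = cong (_ ∷_) (zip-segment f g (suc c) m)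

module ParkingOf {n : ℕ} {v : Vec ℕ n} {K : Marks} (val : Admissible n v K) where
  open FubiniOf {n} {v} {K} val

  preference : ℕ → ℕ
  preference c = rank K (inverse c)
  spot : ℕ → ℕ
  spot c = suc (inverse c)

  -- Car c parks in spot v⁻¹(c + 1) + 1: when its preference is a tie, the spot it prefers is
  -- already taken by its tie partner, who finished just ahead of it and arrived earlier.
  ParkedSoFar : List ℕ → ℕ → Set
  ParkedSoFar occ c = (∀ j → j < c → spot j ∈ occ) × (∀ x → x ∈ occ → Σ ℕ λ j → j < c × spot j ≡ x)

  parks-at-spot : ∀ c occ → c < n → ParkedSoFar occ c → firstFree n occ (preference c) ≡ just (spot c)
  parks-at-spot c occ cn (g1 , g2) = firstFree-spec n occ (preference c) (spot c) (s≤s z≤n) (inverse-< c cn) (rank≤suc K (inverse c)) nin fill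
    where
    nin : spot c ∉ occ
    nin m = nin' (g2 (spot c) m)
      where
      nin' : (Σ ℕ λ j → j < c × spot j ≡ spot c) → ⊥
      nin' (j , jc , e) = <-irrefl (inverse-injective j c (<-trans jc cn) cn (suc-injective e)) jc
    fill : ∀ x → preference c ≤ x → x < spot c → x ∈ occ
    fill x hx xs with rankView K (inverse c)
    ... | inj₁ (e , _) = ⊥-elim (<-irrefl refl (<-≤-trans xs (subst (_≤ x) e hx)))
    ... | inj₂ (p' , e1 , kp' , e2) = subst (_∈ occ) sx (g1 j jc)
      where
      xq : x ≡ inverse c
      xq = ≤-antisym (≤-pred xs) (subst (_≤ x) e2 hx)
      p'n : p' < n
      p'n = ≤-trans (n≤1+n _) (subst (_< n) e1 (inverse-< c cn))
      j = prev p'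
      sx : spot j ≡ x
      sx = trans (cong suc (inverse-prev p' p'n)) (trans (sym e1) (sym xq))
      jc : j < c
      jc = subst (_≤ c) (sym (suc-pred-≥1 (nth v p') (proj₁ (v-range p' p'n))))
             (≤-pred (subst (suc (nth v p') ≤_) (trans (cong (nth v) (sym e1)) (proj₂ (inverse-spec c cn))) (marked⇒ascent p' kp')))

  outcomes-segment : ∀ m c occ → c + m ≤ n → ParkedSoFar occ c → outcomes n occ (segment preference c m) ≡ segment (just ∘ spot) c m
  outcomes-segment zero c occ _ _ = refl
  outcomes-segment (suc m) c occ le gd rewrite parks-at-spot c occ (<-≤-trans (m<m+n c (s≤s z≤n)) le) gd =
    cong (just (spot c) ∷_) (outcomes-segment m (suc c) (spot c ∷ occ) (subst (_≤ n) (+-suc c m) le) (g1' , g2'))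
    where
    g1' : ∀ j → j < suc c → spot j ∈ spot c ∷ occ
    g1' j jl with j ≟ c
    ... | yes refl = here refl
    ... | no ne = there (proj₁ gd j (≤∧≢⇒< (≤-pred jl) ne))
    g2' : ∀ x → x ∈ spot c ∷ occ → Σ ℕ λ j → j < suc c × spot j ≡ x
    g2' x (here refl) = c , ≤-refl , refl
    g2' x (there mm) with proj₂ gd x mm
    ... | j , jl , e = j , m≤n⇒m≤1+n jl , e

  parkingOutcome≡spots : parkingOutcome n r ≡ segment (just ∘ spot) 0 n
  parkingOutcome≡spots = trans (cong (outcomes n []) (trans (toList-tabulateN n preference) (applyUpTo-segment preference 0 n))) (outcomes-segment n 0 [] ≤-refl ((λ _ ()) , (λ _ ())))

  isUnitIntervalPF : IsUnitIntervalPF n r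
  isUnitIntervalPF = (proj₁ isFubini , subst (All (λ o → ∃ λ s' → o ≡ just s')) (sym parkingOutcome≡spots) (All-segment _ 0 n (λ i → spot i , refl))) ,
          subst (All _) (sym (trans (cong₂ zip (trans (toList-tabulateN n preference) (applyUpTo-segment preference 0 n)) parkingOutcome≡spots) (zip-segment preference (just ∘ spot) 0 n)))
            (All-segment _ 0 n unit)
    where
    unit : ∀ i → just (spot i) ≡ just (preference i) ⊎ just (spot i) ≡ just (suc (preference i))
    unit i with rankView K (inverse i)
    ... | inj₁ (e , _) = inj₁ (cong just (sym e))
    ... | inj₂ (p' , e1 , _ , e2) = inj₂ (cong just (cong suc (sym e2)))

indicator-not : ∀ b → indicator (not b) + indicator b ≡ 1
indicator-not true = refl
indicator-not false = refl

length-deduplicate : ∀ B (xs : List ℕ) → All (_< B) xs → length (deduplicate _≟_ xs) ≡ count B (λ a → memberᵇ a xs)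
length-deduplicate B xs a = trans (length-unique B (deduplicate _≟_ xs) (deduplicate-! _≟_ xs) (All.tabulate (λ m → All.lookup a (∈-deduplicate⁻ _≟_ xs m))))
  (Σ-cong B _ _ (λ p _ → cong indicator (⇔⇒≡ (λ e → ∈⇒memberᵇ p xs (∈-deduplicate⁻ _≟_ xs (memberᵇ⇒∈ p _ e)))
                                           (λ e → ∈⇒memberᵇ p _ (∈-deduplicate⁺ _≟_ (memberᵇ⇒∈ p xs e))))))

markedBefore : Marks → ℕ → Bool
markedBefore K zero = false
markedBefore K (suc b) = K b

count-markedBefore : ∀ n K → (∀ p → K p ≡ true → suc p < n) → count n (markedBefore K) ≡ count n K
count-markedBefore zero K kn = refl
count-markedBefore (suc m) K kn = trans (Σ-shift m (λ p → indicator (markedBefore K p))) (sym (trans (cong (count m K +_) (cong indicator km)) (+-identityʳ _)))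
  where
  km : K m ≡ false
  km with K m in e
  ... | false = refl
  ... | true = ⊥-elim (<-irrefl refl (kn m e))

module DistinctOf {n : ℕ} {v : Vec ℕ n} {K : Marks} (val : Admissible n v K) where
  open FubiniOf {n} {v} {K} val

  isValue : ℕ → Bool
  isValue zero = false
  isValue (suc b) = ltb b n ∧ not ((markedBefore K) b)

  markedBefore-unmarked : ∀ p → (∀ p' → p ≡ suc p' → K p' ≡ false) → (markedBefore K) p ≡ false
  markedBefore-unmarked zero _ = refl
  markedBefore-unmarked (suc p) h = h p refl

  isValue⇒member : ∀ a → isValue a ≡ true → memberᵇ a (toList r) ≡ true
  isValue⇒member (suc b) e with ∧-true⁻ {ltb b n} e
  ... | e1 , e2 = ∈⇒memberᵇ _ _ (subst (_∈ toList r) eq (∈-toList⁺ r (prev b) (prev-< b bn)))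
    where
    bn = ltb⇒< b n e1
    pkf : ∀ p' → b ≡ suc p' → K p' ≡ false
    pkf p' refl with K p' in ek
    ... | false = refl
    ... | true = ⊥-elim (true≢false e2 refl)
    eq : nth r (prev b) ≡ suc b
    eq = trans (nth-ranking (prev b) (prev-< b bn)) (trans (cong (rank K) (inverse-prev b bn)) (rank-unmarked K b pkf))

  memberᵇ≡isValue : ∀ a → memberᵇ a (toList r) ≡ isValue a
  memberᵇ≡isValue a = ⇔⇒≡ to' (isValue⇒member a)
    where
    to' : memberᵇ a (toList r) ≡ true → isValue a ≡ true
    to' e with ∈-toList⁻ r a (memberᵇ⇒∈ a _ e)
    ... | c , cn , refl with rankView K (inverse c) | nth-ranking c cn
    ...   | inj₁ (e1 , nb) | e2 rewrite e2 | e1 = subst₂ (λ x y → x ∧ not y ≡ true) (sym (<⇒ltb _ _ (inverse-< c cn))) (sym pk) refl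
      where
      pk : (markedBefore K) (inverse c) ≡ false
      pk = markedBefore-unmarked (inverse c) nb
    ...   | inj₂ (p' , e1 , kp' , e3) | e2 rewrite e2 | e3 | e1 =
            subst₂ (λ x y → x ∧ not y ≡ true) (sym (<⇒ltb _ _ (≤-trans (n≤1+n _) (subst (_< n) e1 (inverse-< c cn))))) (sym pk) refl
      where
      pk : (markedBefore K) p' ≡ false
      pk = markedBefore-unmarked p' (λ p'' e → marked⇒prev-unmarked {n} {v} {K} val p' p'' kp' e)
  count-markedBefore′ : count n (markedBefore K) ≡ count n K
  count-markedBefore′ = count-markedBefore n K marked⇒suc<n

  distinct : distinctCount r ≡ n ∸ count n K
  distinct = begin
    length (deduplicate _≟_ (toList r)) ≡⟨ length-deduplicate (suc n) (toList r) (nth⇒All r (λ c cn → s≤s (subst (_≤ n) (sym (nth-ranking c cn)) (≤-trans (rank≤suc K (inverse c)) (inverse-< c cn))))) ⟩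
    count (suc n) (λ a → memberᵇ a (toList r)) ≡⟨ Σ-cong (suc n) _ _ (λ a _ → cong indicator (memberᵇ≡isValue a)) ⟩
    count (suc n) isValue ≡⟨ Σ-shift n _ ⟩
    count n (λ b → ltb b n ∧ not ((markedBefore K) b)) ≡⟨ Σ-cong n _ _ (λ b bn → cong (λ x → indicator (x ∧ not ((markedBefore K) b))) (<⇒ltb b n bn)) ⟩
    count n (λ b → not ((markedBefore K) b)) ≡⟨ sym (m+n∸n≡m _ (count n (markedBefore K))) ⟩
    count n (λ b → not ((markedBefore K) b)) + count n (markedBefore K) ∸ count n (markedBefore K) ≡⟨ cong₂ _∸_ (trans (sym (Σ-+-distrib n _ _)) (trans (Σ-cong n _ _ (λ b _ → indicator-not ((markedBefore K) b))) (Σ-one n))) count-markedBefore′ ⟩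
    n ∸ count n K ∎
    where open ≡-Reasoning

-- Decomposing a unit Fubini ranking

findIndex : ℕ → (ℕ → Bool) → ℕ
findIndex zero P = 0
findIndex (suc n) P = if P 0 then 0 else suc (findIndex n (P ∘ suc))

findIndex-first : ∀ n P c0 → c0 < n → P c0 ≡ true → (∀ c → c < c0 → P c ≡ false) → findIndex n P ≡ c0
findIndex-first (suc n) P zero _ e _ rewrite e = refl
findIndex-first (suc n) P (suc c0) (s≤s lt) e h rewrite h 0 (s≤s z≤n) =
  cong suc (findIndex-first n (P ∘ suc) c0 lt e (λ c l → h (suc c) (s≤s l)))

findIndex-unique : ∀ n P c0 → c0 < n → P c0 ≡ true → (∀ c → c < n → P c ≡ true → c ≡ c0) → findIndex n P ≡ c0
findIndex-unique n P c0 lt e u = findIndex-first n P c0 lt e h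
  where
  h : ∀ c → c < c0 → P c ≡ false
  h c l with P c in Pc
  ... | false = refl
  ... | true = ⊥-elim (<-irrefl (u c (<-trans l lt) Pc) l)

-- The 0-based position of competitor c when the competitors are sorted by rank and then by arrival;
-- baseOf lists the competitors in that order.
sortedPosition : ∀ {n} → Vec ℕ n → ℕ → ℕ
sortedPosition r c = pred (nth r c) + count c (λ j → eqb (nth r j) (nth r c))

baseOf : (n : ℕ) → Vec ℕ n → Vec ℕ n
baseOf n r = tabulateN n (λ p → suc (findIndex n (λ c → eqb (sortedPosition r c) p)))

swapsOf : (n : ℕ) → Vec ℕ n → Marks
swapsOf n r p = ltb (suc p) n ∧ eqb (nth r (pred (nth (baseOf n r) p))) (nth r (pred (nth (baseOf n r) (suc p))))

module DecomposeFubiniOf {n : ℕ} {v : Vec ℕ n} {K : Marks} (val : Admissible n v K) where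
  open FubiniOf {n} {v} {K} val

  tie-predecessor : ∀ p' c → c < n → K p' ≡ true → inverse c ≡ suc p' → prev p' < c
  tie-predecessor p' c cn kp e = subst (_≤ c) (sym (suc-pred-≥1 (nth v p') (proj₁ (v-range p' p'n))))
             (≤-pred (subst (suc (nth v p') ≤_) (trans (cong (nth v) (sym e)) (proj₂ (inverse-spec c cn))) (marked⇒ascent p' kp)))
    where
    p'n : p' < n
    p'n = ≤-trans (n≤1+n _) (subst (_< n) e (inverse-< c cn))

  sortedPosition≡inverse : ∀ c → c < n → sortedPosition r c ≡ inverse c
  sortedPosition≡inverse c cn with rankView K (inverse c)
  ... | inj₁ (e , nb) = trans (cong₂ _+_ (cong pred (trans (nth-ranking c cn) e)) cz) (+-identityʳ _)
    where
    cz : count c (λ j → eqb (nth r j) (nth r c)) ≡ 0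
    cz = Σ-zero c _ (λ j jc → cong indicator (ne j jc))
      where
      ne : ∀ j → j < c → eqb (nth r j) (nth r c) ≡ false
      ne j jc with eqb (nth r j) (nth r c) in ee
      ... | false = refl
      ... | true with rank-fibre K (inverse j) (inverse c) (trans (sym (nth-ranking j jn)) (trans (eqb⇒≡ _ _ ee) (nth-ranking c cn)))
        where jn = <-trans jc cn
      ...   | inj₁ x = ⊥-elim (<-irrefl (inverse-injective j c (<-trans jc cn) cn x) jc)
      ...   | inj₂ (inj₁ (kj , x)) = ⊥-elim (true≢false kj (nb (inverse j) x))
      ...   | inj₂ (inj₂ (kc , x)) = ⊥-elim (<-asym jc (subst (_< j) (prev-inverse c cn) (tie-predecessor (inverse c) j (<-trans jc cn) kc x)))
  ... | inj₂ (p' , e1 , kp , e2) = trans (cong₂ _+_ (cong pred (trans (nth-ranking c cn) (trans e2 e1))) c1) (trans (+-comm p' 1) (sym e1))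
    where
    j0 = prev p'
    j0c : j0 < c
    j0c = tie-predecessor p' c cn kp e1
    j0n = <-trans j0c cn
    p'n : p' < n
    p'n = ≤-trans (n≤1+n _) (subst (_< n) e1 (inverse-< c cn))
    c1 : count c (λ j → eqb (nth r j) (nth r c)) ≡ 1
    c1 = trans (Σ-single c _ j0 j0c (λ j jc ne → cong indicator (nej j jc ne))) (cong indicator yes0)
      where
      yes0 : eqb (nth r j0) (nth r c) ≡ true
      yes0 = subst (λ z → eqb z (nth r c) ≡ true) (sym eq0) (eqb-refl (nth r c))
        where
        eq0 : nth r j0 ≡ nth r c
        eq0 = trans (nth-ranking j0 j0n) (trans (cong (rank K) (inverse-prev p' p'n))
               (trans (rank-unmarked K p' (λ p'' e → marked⇒prev-unmarked {n} {v} {K} val p' p'' kp e)) (sym (trans (nth-ranking c cn) (trans e2 e1)))))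
      nej : ∀ j → j < c → j ≢ j0 → eqb (nth r j) (nth r c) ≡ false
      nej j jc ne with eqb (nth r j) (nth r c) in ee
      ... | false = refl
      ... | true with rank-fibre K (inverse j) (inverse c) (trans (sym (nth-ranking j (<-trans jc cn))) (trans (eqb⇒≡ _ _ ee) (nth-ranking c cn)))
      ...   | inj₁ x = ⊥-elim (<-irrefl (inverse-injective j c (<-trans jc cn) cn x) jc)
      ...   | inj₂ (inj₁ (kj , x)) = ⊥-elim (ne (trans (sym (prev-inverse j (<-trans jc cn))) (cong prev (suc-injective (trans (sym x) e1)))))
      ...   | inj₂ (inj₂ (kc , x)) = ⊥-elim (true≢false (subst (λ z → K z ≡ true) e1 kc) (marked⇒next-unmarked p' kp))

  baseOf-toFubini : baseOf n r ≡ v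
  baseOf-toFubini = nth-ext _ _ (λ p pn → trans (nth-tabulateN n _ p pn) (trans (cong suc (findIndex-unique n _ (prev p) (prev-< p pn)
          (subst (λ z → eqb z p ≡ true) (sym (trans (sortedPosition≡inverse (prev p) (prev-< p pn)) (inverse-prev p pn))) (eqb-refl p))
          (λ c cn eq → trans (sym (prev-inverse c cn)) (cong prev (trans (sym (sortedPosition≡inverse c cn)) (eqb⇒≡ _ _ eq))))))
          (suc-pred-≥1 (nth v p) (proj₁ (v-range p pn)))))

  swapsOf-toFubini : ∀ p → swapsOf n r p ≡ K p
  swapsOf-toFubini p = trans (cong (λ V → ltb (suc p) n ∧ eqb (nth r (pred (nth V p))) (nth r (pred (nth V (suc p))))) baseOf-toFubini) (go (suc p <? n))
    where
    go : Dec (suc p < n) → ltb (suc p) n ∧ eqb (nth r (prev p)) (nth r (prev (suc p))) ≡ K p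
    go (no nl) rewrite ≮⇒ltb (suc p) n nl with K p in e
    ... | false = refl
    ... | true = ⊥-elim (nl (marked⇒suc<n p e))
    go (yes sn) rewrite <⇒ltb (suc p) n sn = ⇔⇒≡ to' fr
      where
      pn = ≤-trans (n≤1+n _) sn
      l1 : nth r (prev p) ≡ rank K p
      l1 = trans (nth-ranking (prev p) (prev-< p pn)) (cong (rank K) (inverse-prev p pn))
      l2 : nth r (prev (suc p)) ≡ rank K (suc p)
      l2 = trans (nth-ranking (prev (suc p)) (prev-< (suc p) sn)) (cong (rank K) (inverse-prev (suc p) sn))
      to' : eqb (nth r (prev p)) (nth r (prev (suc p))) ≡ true → K p ≡ true
      to' h with rank-fibre K p (suc p) (trans (sym l1) (trans (eqb⇒≡ _ _ h) l2))
      ... | inj₁ x = ⊥-elim (1+n≢n (sym x))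
      ... | inj₂ (inj₁ (kp , _)) = kp
      ... | inj₂ (inj₂ (_ , x)) = ⊥-elim (<-irrefl x (≤-trans (n<1+n p) (n≤1+n _)))
      fr : K p ≡ true → eqb (nth r (prev p)) (nth r (prev (suc p))) ≡ true
      fr kp = subst₂ (λ a b → eqb a b ≡ true) (sym (trans l1 (rank-unmarked K p (λ p'' e → marked⇒prev-unmarked {n} {v} {K} val p p'' kp e))))
                (sym (trans l2 (rank-after-marked K p kp))) (eqb-refl (suc p))

countList : ℕ → List ℕ → ℕ
countList R [] = 0
countList R (x ∷ xs) = indicator (eqb x R) + countList R xs

countList-toList : ∀ {n} (r : Vec ℕ n) R → countList R (toList r) ≡ count n (λ j → eqb (nth r j) R)
countList-toList [] R = refl
countList-toList {suc n} (x ∷ r) R = trans (cong (indicator (eqb x R) +_) (countList-toList r R)) (sym (Σ-shift n _))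

head-filter-sat : ∀ {ℓ} {P : Pred ℕ ℓ} (P? : Decidable P) l s → head (filter P? l) ≡ just s → P s
head-filter-sat P? [] s ()
head-filter-sat P? (x ∷ xs) s e with P? x
... | yes px with e
...   | refl = px
head-filter-sat P? (x ∷ xs) s e | no _ = head-filter-sat P? xs s e

firstFree-unoccupied : ∀ N occ a s → firstFree N occ a ≡ just s → s ∉ occ
firstFree-unoccupied N occ a s e = proj₂ (head-filter-sat (λ s → (a ≤? s) ×-dec ¬? (s ∈? occ)) (spots N) s e)

memberᵇ-∷-mono : ∀ a s occ → indicator (memberᵇ a occ) ≤ indicator (memberᵇ a (s ∷ occ))
memberᵇ-∷-mono a s occ = indicator-mono (λ e → ∈⇒memberᵇ a (s ∷ occ) (there (memberᵇ⇒∈ a occ e)))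
  where
  indicator-mono : ∀ {b c} → (b ≡ true → c ≡ true) → indicator b ≤ indicator c
  indicator-mono {false} f = z≤n
  indicator-mono {true} f rewrite f refl = ≤-refl

memberᵇ-∉ : ∀ s occ → s ∉ occ → memberᵇ s occ ≡ false
memberᵇ-∉ s occ ni = go (memberᵇ s occ) refl
  where
  go : ∀ b → memberᵇ s occ ≡ b → memberᵇ s occ ≡ false
  go false e = e
  go true e = ⊥-elim (ni (memberᵇ⇒∈ s occ e))

UnitStep : ℕ × Maybe ℕ → Set
UnitStep p = proj₂ p ≡ just (proj₁ p) ⊎ proj₂ p ≡ just (suc (proj₁ p))

parks-at-R : ∀ C a0 a1 b0 b1 → a0 ≡ 0 → a1 ≡ 1 → b0 ≤ b1 → 1 + C + (a0 + b0) ≤ C + (a1 + b1)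
parks-at-R C .0 .1 b0 b1 refl refl le = ≤-trans (s≤s (+-monoʳ-≤ C le)) (≤-reflexive (sym (+-suc C b1)))

parks-at-suc-R : ∀ C a0 a1 b0 b1 → a0 ≤ a1 → b0 ≡ 0 → b1 ≡ 1 → 1 + C + (a0 + b0) ≤ C + (a1 + b1)
parks-at-suc-R C a0 a1 .0 .1 le refl refl = ≤-trans (s≤s (+-monoʳ-≤ C (≤-trans (≤-reflexive (+-identityʳ a0)) le)))
  (≤-reflexive (trans (sym (+-suc C a1)) (cong (C +_) (sym (trans (+-suc a1 0) (cong suc (+-identityʳ a1)))))))

multiplicity-step : ∀ R x s occ C → s ∉ occ → UnitStep (x , just s) →
  indicator (eqb x R) + C + (indicator (memberᵇ R occ) + indicator (memberᵇ (suc R) occ)) ≤ C + (indicator (memberᵇ R (s ∷ occ)) + indicator (memberᵇ (suc R) (s ∷ occ)))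
multiplicity-step R x s occ C ni u with x ≟ R
... | no ne rewrite eqb-≢ x R ne = +-monoʳ-≤ C (+-mono-≤ (memberᵇ-∷-mono R s occ) (memberᵇ-∷-mono (suc R) s occ))
... | yes refl rewrite eqb-refl x with u
...   | inj₁ refl = parks-at-R C _ _ _ _ (cong indicator (memberᵇ-∉ x occ ni)) (cong indicator (∈⇒memberᵇ x (x ∷ occ) (here refl))) (memberᵇ-∷-mono (suc x) x occ)
...   | inj₂ refl = parks-at-suc-R C _ _ _ _ (memberᵇ-∷-mono x (suc x) occ) (cong indicator (memberᵇ-∉ (suc x) occ ni)) (cong indicator (∈⇒memberᵇ (suc x) (suc x ∷ occ) (here refl)))

-- Every car preferring R parks in spot R or R + 1, so the number of cars still to come that prefer
-- R plus the number of occupied spots among R, R + 1 never increases.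
multiplicity≤2-outcomes : ∀ N R xs occ → All (λ o → ∃ λ s → o ≡ just s) (outcomes N occ xs) → All UnitStep (zip xs (outcomes N occ xs)) →
           countList R xs + (indicator (memberᵇ R occ) + indicator (memberᵇ (suc R) occ)) ≤ 2
multiplicity≤2-outcomes N R [] occ _ _ = +-mono-≤ (indicator≤1 (memberᵇ R occ)) (indicator≤1 (memberᵇ (suc R) occ))
multiplicity≤2-outcomes N R (x ∷ xs) occ aj au with firstFree N occ x in e
multiplicity≤2-outcomes N R (x ∷ xs) occ ((_ , ()) ∷ aj) au | nothing
multiplicity≤2-outcomes N R (x ∷ xs) occ (_ ∷ aj) (u ∷ au) | just s = ≤-trans key (multiplicity≤2-outcomes N R xs (s ∷ occ) aj au)
  where
  ni : s ∉ occ
  ni = firstFree-unoccupied N occ x s e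
  key : indicator (eqb x R) + countList R xs + (indicator (memberᵇ R occ) + indicator (memberᵇ (suc R) occ)) ≤ countList R xs + (indicator (memberᵇ R (s ∷ occ)) + indicator (memberᵇ (suc R) (s ∷ occ)))
  key = multiplicity-step R x s occ (countList R xs) ni u

multiplicity≤2 : ∀ n (r : Vec ℕ n) → IsUnitIntervalPF n r → ∀ R → count n (λ j → eqb (nth r j) R) ≤ 2
multiplicity≤2 n r ((_ , aj) , au) R = subst (_≤ 2) (trans (+-identityʳ _) (countList-toList r R)) (multiplicity≤2-outcomes n R (toList r) [] aj au)

Σ-mono-bound : ∀ m n f → m ≤ n → Σ< m f ≤ Σ< n f
Σ-mono-bound m zero f z≤n = ≤-refl
Σ-mono-bound m (suc n) f le with m ≟ suc n
... | yes refl = ≤-refl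
... | no ne = ≤-trans (Σ-mono-bound m n f (≤-pred (≤∧≢⇒< le ne))) (m≤m+n _ (f n))

count<n : ∀ n K → 1 ≤ n → (∀ p → K p ≡ true → suc p < n) → count n K < n
count<n (suc m') K _ kn = subst (_< suc m') (count-markedBefore (suc m') K kn)
                     (s≤s (subst (_≤ m') (sym (Σ-shift m' _)) (Σ-≤1 m' _ (λ y _ → indicator≤1 (markedBefore K (suc y))))))

module DecomposeUnitFubini {n : ℕ} {r : Vec ℕ n} (uf : IsUnitFubini n r) where
  inRange : InRange n r
  inRange = proj₁ (proj₁ uf)
  fubini : (i : Fin n) → lookup r i ≡ suc (length (filter (λ x → x <? lookup r i) (toList r)))
  fubini = proj₂ (proj₁ uf)
  unitPF : IsUnitIntervalPF n r
  unitPF = proj₂ uf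

  R : ℕ → ℕ
  R c = nth r c

  rng : ∀ c → c < n → 1 ≤ R c × R c ≤ n
  rng c cn = All⇒nth r inRange c cn

  lowerCount : ℕ → ℕ
  lowerCount c = count n (λ j → ltb (nth r j) (R c))
  tieCount : ℕ → ℕ
  tieCount c = count n (λ j → eqb (nth r j) (R c))
  earlierTies : ℕ → ℕ
  earlierTies c = count c (λ j → eqb (nth r j) (R c))

  ranking≡suc-lower : ∀ c → c < n → R c ≡ suc (lowerCount c)
  ranking≡suc-lower c cn = trans (sym (cong (nth r) ti)) (trans (sym (lookup≡nth r i)) (trans (fubini i) (cong suc
      (trans (length-filter r _) (Σ-cong n _ _ (λ j _ → cong indicator (trans (does-<? (nth r j) (lookup r i)) (cong (ltb (nth r j)) (trans (lookup≡nth r i) (cong (nth r) ti))))))))))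
    where
    i = Fin.fromℕ< cn
    ti : toℕ i ≡ c
    ti = Finₚ.toℕ-fromℕ< cn

  pred-ranking : ∀ c → c < n → pred (R c) ≡ lowerCount c
  pred-ranking c cn = cong pred (ranking≡suc-lower c cn)

  count-prefix< : ∀ (P : ℕ → Bool) c m → c < m → m ≤ n → P c ≡ true → count c P + 1 ≤ count m P
  count-prefix< P c m cm mn e = subst (_≤ count m P) (cong (count c P +_) (cong indicator e)) (Σ-mono-bound (suc c) m _ cm)

  earlierTies<tieCount : ∀ c → c < n → earlierTies c + 1 ≤ tieCount c
  earlierTies<tieCount c cn = count-prefix< _ c n cn ≤-refl (eqb-refl (R c))

  earlierTies≤1 : ∀ c → c < n → earlierTies c ≤ 1
  earlierTies≤1 c cn = ≤-pred (subst (_≤ 2) (+-comm (earlierTies c) 1) (≤-trans (earlierTies<tieCount c cn) (multiplicity≤2 n r unitPF (R c))))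

  lower+ties≤n : ∀ c → lowerCount c + tieCount c ≤ n
  lower+ties≤n c = subst (_≤ n) (Σ-+-distrib n _ _) (Σ-≤1 n _ (λ j _ → pw (nth r j)))
    where
    pw : ∀ x → indicator (ltb x (R c)) + indicator (eqb x (R c)) ≤ 1
    pw x with x <? R c
    ... | yes lt rewrite <⇒ltb x (R c) lt | eqb-≢ x (R c) (<⇒≢ lt) = ≤-refl
    ... | no nl rewrite ≮⇒ltb x (R c) nl with eqb x (R c)
    ...   | true = ≤-refl
    ...   | false = z≤n

  slot : ℕ → ℕ
  slot = sortedPosition r

  slot≡ : ∀ c → c < n → slot c ≡ lowerCount c + earlierTies c
  slot≡ c cn = cong (_+ earlierTies c) (pred-ranking c cn)

  suc-earlierTies≤tieCount : ∀ c → c < n → suc (earlierTies c) ≤ tieCount c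
  suc-earlierTies≤tieCount c cn = subst (_≤ tieCount c) (+-comm (earlierTies c) 1) (earlierTies<tieCount c cn)

  slot-< : ∀ c → c < n → slot c < n
  slot-< c cn = subst (_< n) (sym (slot≡ c cn)) (≤-trans (≤-reflexive (sym (+-suc (lowerCount c) (earlierTies c))))
                  (≤-trans (+-monoʳ-≤ (lowerCount c) (suc-earlierTies≤tieCount c cn)) (lower+ties≤n c)))

  lower+ties≤lower : ∀ c d → R c < R d → lowerCount c + tieCount c ≤ lowerCount d
  lower+ties≤lower c d lt = subst (_≤ lowerCount d) (Σ-+-distrib n _ _) (Σ-mono n _ _ (λ j _ → pw (nth r j)))
    where
    pw : ∀ x → indicator (ltb x (R c)) + indicator (eqb x (R c)) ≤ indicator (ltb x (R d))
    pw x with x <? R c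
    ... | yes l rewrite <⇒ltb x (R c) l | eqb-≢ x (R c) (<⇒≢ l) | <⇒ltb x (R d) (<-trans l lt) = ≤-refl
    ... | no nl rewrite ≮⇒ltb x (R c) nl with x ≟ R c
    ...   | yes refl rewrite eqb-refl x | <⇒ltb x (R d) lt = ≤-refl
    ...   | no ne rewrite eqb-≢ x (R c) ne = z≤n

  slot-<-mono : ∀ c d → c < n → d < n → R c < R d → slot c < slot d
  slot-<-mono c d cn dn lt = subst₂ _<_ (sym (slot≡ c cn)) (sym (slot≡ d dn))
     (≤-trans (≤-reflexive (sym (+-suc (lowerCount c) (earlierTies c)))) (≤-trans (+-monoʳ-≤ (lowerCount c) (suc-earlierTies≤tieCount c cn))
        (≤-trans (lower+ties≤lower c d lt) (m≤m+n (lowerCount d) (earlierTies d)))))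

  earlierTies-mono : ∀ c d → d ≤ c → R c ≡ R d → earlierTies d ≤ earlierTies c
  earlierTies-mono c d le e = subst (λ z → count d (λ j → eqb (nth r j) z) ≤ earlierTies c) e (Σ-mono-bound d c _ le)

  earlierTies-< : ∀ c d → c < d → d < n → R c ≡ R d → earlierTies c + 1 ≤ earlierTies d
  earlierTies-< c d cd dn e = subst (λ z → count c (λ j → eqb (nth r j) z) + 1 ≤ earlierTies d) (sym e)
                        (count-prefix< _ c d cd (<⇒≤ dn) (trans (cong (eqb (nth r c)) (sym e)) (eqb-refl (R c))))

  slot-injective : InjectiveBelow n slot
  slot-injective c d cn dn eq with <-cmp (R c) (R d)
  ... | tri< lt _ _ = ⊥-elim (<-irrefl eq (slot-<-mono c d cn dn lt))
  ... | tri> _ _ gt = ⊥-elim (<-irrefl (sym eq) (slot-<-mono d c dn cn gt))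
  ... | tri≈ _ e _ with <-cmp c d
  ...   | tri≈ _ x _ = x
  ...   | tri< cd _ _ = ⊥-elim (<-irrefl (+-cancelˡ-≡ (lowerCount c) _ _ e2) (subst (_≤ earlierTies d) (+-comm (earlierTies c) 1) (earlierTies-< c d cd dn e)))
    where
    e2 : lowerCount c + earlierTies c ≡ lowerCount c + earlierTies d
    e2 = trans (sym (slot≡ c cn)) (trans eq (trans (slot≡ d dn) (cong (_+ earlierTies d) (cong (λ z → count n (λ j → ltb (nth r j) z)) (sym e)))))
  ...   | tri> _ _ dc = ⊥-elim (<-irrefl (+-cancelˡ-≡ (lowerCount d) _ _ e2) (subst (_≤ earlierTies c) (+-comm (earlierTies d) 1) (earlierTies-< d c dc cn (sym e))))
    where
    e2 : lowerCount d + earlierTies d ≡ lowerCount d + earlierTies c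
    e2 = trans (sym (slot≡ d dn)) (trans (sym eq) (trans (slot≡ c cn) (cong (_+ earlierTies c) (cong (λ z → count n (λ j → ltb (nth r j) z)) e))))

  base : Vec ℕ n
  base = baseOf n r
  swaps : Marks
  swaps = swapsOf n r

  base-slot : ∀ c → c < n → nth base (slot c) ≡ suc c
  base-slot c cn = trans (nth-tabulateN n _ (slot c) (slot-< c cn)) (cong suc (findIndex-unique n _ c cn (eqb-refl (slot c))
                 (λ d dn e → slot-injective d c dn cn (eqb⇒≡ _ _ e))))

  slotOnto : ∀ p → p < n → Σ ℕ λ c → c < n × slot c ≡ p
  slotOnto p pn = injective⇒surjective n slot slot-injective slot-< p pn

  rankAt : ℕ → ℕ
  rankAt p = nth r (pred (nth base p))

  rankAt-slot : ∀ c → c < n → rankAt (slot c) ≡ R c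
  rankAt-slot c cn = cong (λ z → nth r (pred z)) (base-slot c cn)

  base-perm : PermAt n base
  base-perm = rg , inj
    where
    rg : ∀ p → p < n → 1 ≤ nth base p × nth base p ≤ n
    rg p pn with slotOnto p pn
    ... | c , cn , refl rewrite base-slot c cn = s≤s z≤n , cn
    inj : InjectiveBelow n (nth base)
    inj p p' pn pn' e with slotOnto p pn | slotOnto p' pn'
    ... | c , cn , refl | c' , cn' , refl = cong slot (suc-injective (trans (sym (base-slot c cn)) (trans e (base-slot c' cn'))))

  swaps⇒tie : ∀ p → swaps p ≡ true → suc p < n × rankAt p ≡ rankAt (suc p)
  swaps⇒tie p h = ltb⇒< (suc p) n (proj₁ (∧-true⁻ {ltb (suc p) n} h)) , eqb⇒≡ _ _ (proj₂ (∧-true⁻ {ltb (suc p) n} h))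

  slot-bounds : ∀ c → c < n → pred (R c) ≤ slot c × slot c ≤ suc (pred (R c))
  slot-bounds c cn = subst (λ z → z ≤ slot c × slot c ≤ suc z) (sym (pred-ranking c cn))
                     (subst (λ z → lowerCount c ≤ z × z ≤ suc (lowerCount c)) (sym (slot≡ c cn))
                       (m≤m+n _ _ , ≤-trans (+-monoʳ-≤ (lowerCount c) (earlierTies≤1 c cn)) (≤-reflexive (+-comm (lowerCount c) 1))))

  admissible : Admissible n base swaps
  admissible = base-perm , (λ p h → proj₁ (swaps⇒tie p h)) , nadj , inc
    where
    nadj : ∀ p → swaps p ≡ true → swaps (suc p) ≡ false
    nadj p h with swaps (suc p) in e
    ... | false = refl
    ... | true with swaps⇒tie p h | swaps⇒tie (suc p) e | slotOnto p (≤-trans (n≤1+n _) (proj₁ (swaps⇒tie p h))) | slotOnto (suc (suc p)) (proj₁ (swaps⇒tie (suc p) e))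
    ...   | _ , e1 | s2 , e2 | c0 , c0n , refl | c2 , c2n , e3 = ⊥-elim (<-irrefl refl (<-≤-trans (≤-trans (n<1+n _) (≤-reflexive (sym e3))) chain))
      where
      rr : R c2 ≡ R c0
      rr = trans (sym (rankAt-slot c2 c2n)) (trans (cong rankAt e3) (trans (sym e2) (trans (sym e1) (rankAt-slot c0 c0n))))
      chain : slot c2 ≤ suc (slot c0)
      chain = ≤-trans (proj₂ (slot-bounds c2 c2n)) (s≤s (subst (_≤ slot c0) (cong pred (sym rr)) (proj₁ (slot-bounds c0 c0n))))
    inc : ∀ p → swaps p ≡ true → nth base p < nth base (suc p)
    inc p h with swaps⇒tie p h
    ... | sn , e with slotOnto p (≤-trans (n≤1+n _) sn) | slotOnto (suc p) sn
    ...   | c0 , c0n , refl | c1 , c1n , e1 = subst₂ _<_ (sym (base-slot c0 c0n)) (sym (trans (cong (nth base) (sym e1)) (base-slot c1 c1n))) (s≤s c01)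
      where
      rr : R c0 ≡ R c1
      rr = trans (sym (rankAt-slot c0 c0n)) (trans e (trans (cong rankAt (sym e1)) (rankAt-slot c1 c1n)))
      c01 : c0 < c1
      c01 with <-cmp c0 c1
      ... | tri< x _ _ = x
      ... | tri≈ _ refl _ = ⊥-elim (1+n≢n (sym e1))
      ... | tri> _ _ x = ⊥-elim (<-irrefl refl (<-≤-trans eqs (subst (λ z → z ≤ slot c0) (sym slot1) (subst (lowerCount c0 + earlierTies c1 ≤_) (sym (slot≡ c0 c0n)) (+-monoʳ-≤ (lowerCount c0) (earlierTies-mono c0 c1 (<⇒≤ x) rr))))))
        where
        slot1 : slot c1 ≡ lowerCount c0 + earlierTies c1
        slot1 = trans (slot≡ c1 c1n) (cong (_+ earlierTies c1) (cong (λ z → count n (λ j → ltb (nth r j) z)) (sym rr)))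
        eqs : slot c0 < slot c1
        eqs = subst (slot c0 <_) (sym e1) (n<1+n _)

  base-injective : InjectiveBelow n (nth base)
  base-injective = proj₂ base-perm

  rank-slot-first : ∀ c → c < n → earlierTies c ≡ 0 → rank swaps (slot c) ≡ R c
  rank-slot-first c cn none = trans (cong (rank swaps) slot≡m) (trans (rank-unmarked swaps m no-tie) (suc-pred-≥1 (R c) (proj₁ (rng c cn))))
    where
    m = pred (R c)
    slot≡m : slot c ≡ m
    slot≡m = trans (slot≡ c cn) (trans (cong (lowerCount c +_) none) (trans (+-identityʳ _) (sym (pred-ranking c cn))))
    no-tie : ∀ p' → m ≡ suc p' → swaps p' ≡ false
    no-tie p' e' with swaps p' in ek
    ... | false = refl
    ... | true with swaps⇒tie p' ek
    ...   | sn , eρ with slotOnto p' (≤-trans (n≤1+n _) sn)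
    ...     | d , dn , refl = ⊥-elim (<-irrefl refl (<-≤-trans (≤-reflexive (sym e')) (subst (λ z → pred z ≤ slot d) rd (proj₁ (slot-bounds d dn)))))
      where
      rd : R d ≡ R c
      rd = trans (sym (rankAt-slot d dn)) (trans eρ (trans (cong rankAt (sym (trans slot≡m e'))) (rankAt-slot c cn)))

  rank-slot-second : ∀ c → c < n → earlierTies c ≡ 1 → rank swaps (slot c) ≡ R c
  rank-slot-second c cn one = trans (cong (rank swaps) slot≡suc-m) (trans (rank-after-marked swaps m tie) (suc-pred-≥1 (R c) (proj₁ (rng c cn))))
    where
    m = pred (R c)
    slot≡suc-m : slot c ≡ suc m
    slot≡suc-m = trans (slot≡ c cn) (trans (cong (lowerCount c +_) one) (trans (+-comm _ 1) (cong suc (sym (pred-ranking c cn)))))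
    earlier : Σ ℕ λ j → j < c × indicator (eqb (nth r j) (R c)) ≢ 0
    earlier = Σ≢0⇒∃ c _ (λ x → 1+n≢0 (trans (sym one) x))
    j = proj₁ earlier
    jc = proj₁ (proj₂ earlier)
    jn = <-trans jc cn
    indicator≢0 : ∀ b → indicator b ≢ 0 → b ≡ true
    indicator≢0 true _ = refl
    indicator≢0 false ne = ⊥-elim (ne refl)
    rj : R j ≡ R c
    rj = eqb⇒≡ _ _ (indicator≢0 (eqb (nth r j) (R c)) (proj₂ (proj₂ earlier)))
    j-first : earlierTies j ≡ 0
    j-first = n≤0⇒n≡0 (≤-pred (subst (_≤ 1) (+-comm (earlierTies j) 1) (subst (earlierTies j + 1 ≤_) one (earlierTies-< j c jc cn rj))))
    slot-j : slot j ≡ m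
    slot-j = trans (slot≡ j jn) (trans (cong (lowerCount j +_) j-first) (trans (+-identityʳ _) (trans (sym (pred-ranking j jn)) (cong pred rj))))
    tie : swaps m ≡ true
    tie = subst₂ (λ a b → a ∧ b ≡ true) (sym (<⇒ltb (suc m) n (subst (_< n) slot≡suc-m (slot-< c cn))))
            (sym (subst₂ (λ a b → eqb a b ≡ true) (sym (trans (cong rankAt (sym slot-j)) (trans (rankAt-slot j jn) rj)))
                    (sym (trans (cong rankAt (sym slot≡suc-m)) (rankAt-slot c cn))) (eqb-refl (R c)))) refl

  rank-slot : ∀ c → c < n → rank swaps (slot c) ≡ R c
  rank-slot c cn = by-ties (earlierTies c) refl
    where
    by-ties : ∀ x → earlierTies c ≡ x → rank swaps (slot c) ≡ R c
    by-ties zero e = rank-slot-first c cn e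
    by-ties (suc zero) e = rank-slot-second c cn e
    by-ties (suc (suc x)) e with subst (_≤ 1) e (earlierTies≤1 c cn)
    ... | s≤s ()

  toFubini-base-swaps : toFubini n base swaps ≡ r
  toFubini-base-swaps = nth-ext _ _ (λ c cn → trans (nth-tabulateN n _ c cn) (trans (cong (rank swaps)
         (trans (cong (position base) (sym (base-slot c cn))) (position-nth base base-injective (slot c) (slot-< c cn)))) (rank-slot c cn)))

  count-swaps : ∀ k → 1 ≤ n → distinctCount r ≡ n ∸ k → count n swaps ≡ k
  count-swaps k n1 dk = go (k ≤? n)
    where
    open DistinctOf {n} {base} {swaps} admissible using (distinct)
    d1 : n ∸ count n swaps ≡ n ∸ k
    d1 = trans (sym (subst (λ z → distinctCount z ≡ n ∸ count n swaps) toFubini-base-swaps distinct)) dk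
    c<n : count n swaps < n
    c<n = count<n n swaps n1 (proj₁ (proj₂ admissible))
    go : Dec (k ≤ n) → count n swaps ≡ k
    go (yes kn) = ∸-cancelˡ-≡ (<⇒≤ c<n) kn d1
    go (no nk) = ⊥-elim (<⇒≱ c<n (m∸n≡0⇒m≤n (trans d1 (m≤n⇒m∸n≡0 (<⇒≤ (≰⇒> nk))))))

rankingToInterval : (n : ℕ) → Vec ℕ n → Vec ℕ n × Vec ℕ n
rankingToInterval n r = baseOf n r , applySwaps n (baseOf n r) (swapsOf n r)

intervalToRanking : (n : ℕ) → Vec ℕ n × Vec ℕ n → Vec ℕ n
intervalToRanking n (v , w) = toFubini n v (swapsBetween n v w)

module Bijection (n k : ℕ) where

  rankingToInterval-isBooleanInterval : 1 ≤ n → ∀ r → IsUnitFubini n r × distinctCount r ≡ n ∸ k →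
                                        IsBooleanInterval n k (rankingToInterval n r)
  rankingToInterval-isBooleanInterval n≥1 r (uf , distinct) =
    IntervalOfSwaps.isBooleanInterval {n} {k} {baseOf n r} {swapsOf n r}
      (DecomposeUnitFubini.admissible {n} {r} uf) (DecomposeUnitFubini.count-swaps {n} {r} uf k n≥1 distinct)

  intervalToRanking-isUnitFubini : ∀ vw → IsBooleanInterval n k vw →
                                   IsUnitFubini n (intervalToRanking n vw) × distinctCount (intervalToRanking n vw) ≡ n ∸ k
  intervalToRanking-isUnitFubini (v , w) bi =
    (FubiniOf.isFubini {n} {v} {K} admissible , ParkingOf.isUnitIntervalPF {n} {v} {K} admissible) ,
    trans (DistinctOf.distinct {n} {v} {K} admissible) (cong (n ∸_) count≡k)
    where
    K : Marks
    K = swapsBetween n v w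
    spec : Admissible n v K × count n K ≡ k × w ≡ applySwaps n v K
    spec = SwapsOfInterval.swapsBetween-spec {n} {k} {v} {w} bi
    admissible : Admissible n v K
    admissible = proj₁ spec
    count≡k : count n K ≡ k
    count≡k = proj₁ (proj₂ spec)

  intervalToRanking-rankingToInterval : ∀ r → IsUnitFubini n r × distinctCount r ≡ n ∸ k →
                                        intervalToRanking n (rankingToInterval n r) ≡ r
  intervalToRanking-rankingToInterval r (uf , _) =
    trans (toFubini-cong n (baseOf n r) _ _ (swapsBetween-applySwaps {n} {baseOf n r} {swapsOf n r} (DecomposeUnitFubini.admissible {n} {r} uf)))
          (DecomposeUnitFubini.toFubini-base-swaps {n} {r} uf)

  rankingToInterval-intervalToRanking : ∀ vw → IsBooleanInterval n k vw → rankingToInterval n (intervalToRanking n vw) ≡ vw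
  rankingToInterval-intervalToRanking (v , w) bi = cong₂ _,_ base≡v (begin
      applySwaps n (baseOf n r) (swapsOf n r) ≡⟨ cong (λ z → applySwaps n z (swapsOf n r)) base≡v ⟩
      applySwaps n v (swapsOf n r)            ≡⟨ applySwaps-cong n v _ _ (DecomposeFubiniOf.swapsOf-toFubini {n} {v} {K} admissible) ⟩
      applySwaps n v K                        ≡⟨ sym (proj₂ (proj₂ spec)) ⟩
      w                                       ∎)
    where
    open ≡-Reasoning
    K : Marks
    K = swapsBetween n v w
    r : Vec ℕ n
    r = toFubini n v K
    spec : Admissible n v K × count n K ≡ k × w ≡ applySwaps n v K
    spec = SwapsOfInterval.swapsBetween-spec {n} {k} {v} {w} bi
    admissible : Admissible n v K
    admissible = proj₁ spec
    base≡v : baseOf n r ≡ v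
    base≡v = DecomposeFubiniOf.baseOf-toFubini {n} {v} {K} admissible

theorem1p2 : (n k : ℕ) → 1 ≤ n →
    SubsetBijection {Vec ℕ n} {Vec ℕ n × Vec ℕ n}
      (λ r → IsUnitFubini n r × distinctCount r ≡ n ∸ k)
      (IsBooleanInterval n k)
theorem1p2 n k n≥1 =
  rankingToInterval n , intervalToRanking n ,
  rankingToInterval-isBooleanInterval n≥1 , intervalToRanking-isUnitFubini ,
  intervalToRanking-rankingToInterval , rankingToInterval-intervalToRanking
  where open Bijection n k
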